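{- For every integer $n\geq 0$, $C_n^{(3)}=T_n$, where $T_n$ is the number of isomorphism classes of t-hexagons of perimeter $2n$.
   Context: Triangular tiling: the regular tiling of the Euclidean plane by equilateral triangles of side $1$, with one family of tiling lines horizontal; tiling lines form three parallel families. A tiling strip of a family is the closed region between two (possibly equal) tiling lines of that family. A t-hexagon is a nonempty intersection of three tiling strips, one from each family (a vertex, a segment on a tiling line, or a convex polygon with 3 to 6 sides). Its perimeter is its perimeter as a polygon, a point having perimeter $0$ and a segment having perimeter twice its length. Two t-hexagons are isomorphic if some isometry of the plane mapping the tiling onto itself maps one onto the other. $C_n^{(3)}$: let $\Lambda_3=\mathbb{Z}_{\geq0}^3$, $\mathbf{e}(1)=(1,0,0)$, $X_3=\{(1,-2,0),(-2,1,0),(-1,-1,1),(0,0,-1)\}$; for $\mathbf{v},\mathbf{w}\in\Lambda_3$ put $\mathbf{v}\lessdot\mathbf{w}$ if $\mathbf{v}-\mathbf{w}\in X_3$, and let $\prec$ be the transitive closure of $\lessdot$ on $\Lambda_3$. Then $C_n^{(3)}=|\{n\mathbf{e}(1)\}\cup\{\mathbf{w}\in\Lambda_3:\mathbf{w}\prec n\mathbf{e}(1)\}|$. -}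

module Defs where

open import Data.Nat as ℕ using (ℕ; zero; suc)
open import Data.Integer as ℤ using (ℤ; +_; _+_; _-_; -_; _≤_; _≤?_; _≟_; _⊔_)
open import Data.Product using (Σ; _×_; _,_; proj₁; proj₂)
open import Data.Sum using (_⊎_)
open import Data.Bool using (Bool; true; false)
open import Data.List using (List; []; _∷_; map; filter; concatMap; length; foldr; upTo)
open import Data.List.Membership.Propositional using (_∈_)
open import Data.List.Relation.Unary.All using (All)
open import Data.List.Relation.Unary.Any using (Any)
open import Data.List.Relation.Unary.AllPairs using (AllPairs)
open import Data.List.Relation.Unary.Unique.Propositional using (Unique)
open import Relation.Binary.PropositionalEquality using (_≡_)
open import Relation.Binary.Construct.Closure.Transitive using (TransClosure)
open import Relation.Nullary using (¬_; Dec; _×-dec_)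
open import Function.Bundles using (_⇔_)

Vec3ℕ : Set
Vec3ℕ = ℕ × ℕ × ℕ

Vec3ℤ : Set
Vec3ℤ = ℤ × ℤ × ℤ

toℤ³ : Vec3ℕ → Vec3ℤ
toℤ³ (a , b , c) = (+ a , + b , + c)

_-³_ : Vec3ℤ → Vec3ℤ → Vec3ℤ
(a , b , c) -³ (a' , b' , c') = (a - a' , b - b' , c - c')

X₃ : List Vec3ℤ
X₃ = (+ 1 , - (+ 2) , + 0) ∷ (- (+ 2) , + 1 , + 0) ∷ (- (+ 1) , - (+ 1) , + 1)
     ∷ (+ 0 , + 0 , - (+ 1)) ∷ []

_⋖_ : Vec3ℕ → Vec3ℕ → Set
v ⋖ w = (toℤ³ v -³ toℤ³ w) ∈ X₃

_≺_ : Vec3ℕ → Vec3ℕ → Set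
_≺_ = TransClosure _⋖_

ne₁ : ℕ → Vec3ℕ
ne₁ n = (n , 0 , 0)

CSet : ℕ → Vec3ℕ → Set
CSet n w = (w ≡ ne₁ n) ⊎ (w ≺ ne₁ n)

HasCard : {A : Set} → (A → Set) → ℕ → Set
HasCard {A} P k = Σ (List A) λ L → (length L ≡ k) × Unique L × (∀ x → (x ∈ L) ⇔ P x)

CIs : ℕ → ℕ → Set
CIs n k = HasCard (CSet n) k

-- Coordinates: a point of the plane is written in "cube coordinates"
-- (x , y , z) with x + y + z = 0; the three families of tiling lines
-- are x = i, y = j, z = k (i, j, k ∈ ℤ), and the vertices of the tiling
-- are the integer points.  Unit edges join vertices differing by a
-- permutation of (1,-1,0).  We store only (x , y); z = -(x + y).

Pt : Set
Pt = ℤ × ℤ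

zc : Pt → ℤ
zc (x , y) = - (x + y)

-- A t-hexagon: intersection of the strips a₁ ≤ x ≤ b₁, a₂ ≤ y ≤ b₂,
-- a₃ ≤ z ≤ b₃ (a strip between two possibly equal tiling lines), required
-- to be nonempty.  It is a convex polygon (or point/segment) all of whose
-- vertices are tiling vertices, so it is determined by (and is identified
-- here with) the set of tiling vertices it contains.
record THex : Set where
  constructor thex
  field
    a₁ b₁ a₂ b₂ a₃ b₃ : ℤ
    a₁≤b₁ : a₁ ≤ b₁
    a₂≤b₂ : a₂ ≤ b₂
    a₃≤b₃ : a₃ ≤ b₃

open THex public

_∈ᴴ_ : Pt → THex → Set
p ∈ᴴ H = (a₁ H ≤ proj₁ p × proj₁ p ≤ b₁ H) × (a₂ H ≤ proj₂ p × proj₂ p ≤ b₂ H)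
         × (a₃ H ≤ zc p × zc p ≤ b₃ H)

_∈ᴴ?_ : (p : Pt) → (H : THex) → Dec (p ∈ᴴ H)
p ∈ᴴ? H = ((a₁ H ≤? proj₁ p) ×-dec (proj₁ p ≤? b₁ H))
          ×-dec ((a₂ H ≤? proj₂ p) ×-dec (proj₂ p ≤? b₂ H))
          ×-dec ((a₃ H ≤? zc p) ×-dec (zc p ≤? b₃ H))

NonEmpty : THex → Set
NonEmpty H = Σ Pt λ p → p ∈ᴴ H

range : ℤ → ℤ → List ℤ
range a b = map (λ k → a + + k) (upTo (suc ℤ.∣ b - a ∣))

points : THex → List Pt
points H = filter (λ p → p ∈ᴴ? H)
  (concatMap (λ x → map (λ y → (x , y)) (range (a₂ H) (b₂ H))) (range (a₁ H) (b₁ H)))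

dirs : List (Pt → ℤ)
dirs = proj₁ ∷ proj₂ ∷ zc ∷ (λ p → - proj₁ p) ∷ (λ p → - proj₂ p) ∷ (λ p → - zc p) ∷ []

maxOver : (Pt → ℤ) → (H : THex) → NonEmpty H → ℤ
maxOver f H (w , _) = foldr (λ p m → f p ⊔ m) (f w) (points H)

-- the face of H in direction f is the segment (or vertex) of H where f is
-- maximal; its length is (number of tiling vertices on it) - 1.
faceLength : (Pt → ℤ) → (H : THex) → NonEmpty H → ℕ
faceLength f H ne =
  length (filter (λ p → f p ≟ maxOver f H ne) (points H)) ℕ.∸ 1

-- perimeter: sum of the lengths of the faces in the six directions.
-- (The edges of a t-hexagon lie on tiling lines, so this is its perimeter
-- as a polygon; a segment gets twice its length, a point gets 0.)
perimeter : (H : THex) → NonEmpty H → ℕ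
perimeter H ne = foldr (λ f s → faceLength f H ne ℕ.+ s) 0 dirs

-- Symmetries of the tiling: p ↦ σ(ε p) + t with σ a permutation of the
-- three cube coordinates, ε = ±1 and t a tiling vertex (translation).
-- This is the full symmetry group p6m of the triangular tiling.

data Perm3 : Set where
  p123 p132 p213 p231 p312 p321 : Perm3

applyPerm : Perm3 → Vec3ℤ → Vec3ℤ
applyPerm p123 (x , y , z) = (x , y , z)
applyPerm p132 (x , y , z) = (x , z , y)
applyPerm p213 (x , y , z) = (y , x , z)
applyPerm p231 (x , y , z) = (y , z , x)
applyPerm p312 (x , y , z) = (z , x , y)
applyPerm p321 (x , y , z) = (z , y , x)

record TileSym : Set where
  constructor tsym
  field
    perm  : Perm3
    flip  : Bool
    shift : Pt

lift : Pt → Vec3ℤ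
lift p = (proj₁ p , proj₂ p , zc p)

applySym : TileSym → Pt → Pt
applySym (tsym σ ε (t₁ , t₂)) p with applyPerm σ (lift p)
... | (x , y , _) with ε
...   | false = (x + t₁ , y + t₂)
...   | true  = (- x + t₁ , - y + t₂)

_≅_ : THex → THex → Set
H ≅ H' = Σ TileSym λ g → ∀ p → (p ∈ᴴ H) ⇔ (applySym g p ∈ᴴ H')

record THexPer (m : ℕ) : Set where
  constructor mk
  field
    hex   : THex
    nonempty : NonEmpty hex
    per   : perimeter hex nonempty ≡ m

open THexPer public

TIs : ℕ → ℕ → Set
TIs n k = Σ (List (THexPer (2 ℕ.* n))) λ L →
  (length L ≡ k)
  × AllPairs (λ H H' → ¬ (hex H ≅ hex H')) L
  × (∀ (H : THexPer (2 ℕ.* n)) → Any (λ H' → hex H ≅ hex H') L)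

{-# OPTIONS --safe #-}
-- Every move in X₃ changes the weight a + 2b + 3c of a point by 0 or 3, and conversely every
-- (a , b , c) of weight n - 3β (β ≥ 0) climbs to n e(1); so C_n^(3) counts the solutions of
-- a + 2b + 3c + 3β = n.
--
-- A t-hexagon is the intersection of the lattice triangles x ≥ l₁, y ≥ l₂, z ≥ l₃ of side
-- A = -(l₁ + l₂ + l₃) and x ≤ u₁, y ≤ u₂, z ≤ u₃ of side B = u₁ + u₂ + u₃ (cube coordinates,
-- x + y + z = 0).  Once the bounds are tightened to the extreme coordinates of its vertices, the
-- widths wᵢ = uᵢ - lᵢ satisfy 0 ≤ wᵢ ≤ A, B, its six sides are A - wᵢ and B - wᵢ, and its
-- perimeter is w₁ + w₂ + w₃ = A + B.  A tiling symmetry permutes the widths, may swap A and B and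
-- translates, so each class has a unique representative with w₁ ≤ w₂ ≤ w₃ and A ≤ B, and
-- (w₂ - w₁ , w₃ - w₂ , A - w₃ , (B - A) / 2) is an (a , b , c , β) as above with n = (A + B) / 2.
module Submission where

open import Data.Bool using (Bool; true; false)
open import Data.Integer as ℤ using (ℤ; +_; -[1+_]; _+_; _-_; -_; _≤_; ∣_∣; _⊔_)
import Data.Integer.Properties as ℤ
open import Algebra.Properties.AbelianGroup ℤ.+-0-abelianGroup using () renaming (∙-cancelˡ to +-cancelˡ)
open import Data.Integer.Tactic.RingSolver using (solve; solve-∀)
open import Data.List using (List; []; _∷_; map; filter; length; foldr; upTo; concatMap; cartesianProduct; _++_)
open import Data.List.Membership.Propositional using (_∈_; mapWith∈)
open import Data.List.Membership.Propositional.Properties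
  using (∈-filter⁺; ∈-filter⁻; ∈-cartesianProduct⁺; ∈-upTo⁺; ∈-upTo⁻; ∈-map⁺; ∈-map⁻)
open import Data.List.Membership.Propositional.Properties.WithK using (unique∧set⇒bag)
open import Data.List.Membership.Setoid.Properties using (length-mapWith∈)
open import Data.List.Properties using (length-map; length-upTo)
open import Data.List.Relation.Binary.BagAndSetEquality using (∼bag⇒↭)
open import Data.List.Relation.Binary.Permutation.Propositional.Properties using (↭-length)
open import Data.List.Relation.Unary.All using (All)
open import Data.List.Relation.Unary.AllPairs using (AllPairs)
open import Data.List.Relation.Unary.Any using (Any; here; there)
open import Data.List.Relation.Unary.Any.Properties using (mapWith∈⁺)
open import Data.List.Relation.Unary.Unique.Propositional using (Unique)
import Data.List.Relation.Unary.Unique.Propositional.Properties as Unique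
open import Data.Nat as ℕ using (ℕ; zero; suc; z≤n; s≤s)
open import Data.Nat.Divisibility using (_∣_; _∣?_; divides)
import Data.Nat.Properties as ℕ
import Data.Nat.Tactic.RingSolver as ℕ-Solver
open import Data.Product using (Σ; _×_; _,_; proj₁; proj₂)
open import Data.Product.Function.NonDependent.Propositional using (_×-⇔_)
open import Data.Sum using (_⊎_; inj₁; inj₂)
open import Defs
open import Function using (_∘_; id; _∋_)
open import Function.Bundles using (_⇔_; mk⇔; Equivalence)
open import Function.Construct.Composition using (_⇔-∘_)
open import Function.Construct.Identity using (⇔-id)
open import Function.Construct.Symmetry using (⇔-sym)
open import Relation.Binary.Construct.Closure.ReflexiveTransitive using (Star; _◅_; _◅◅_) renaming (ε to ε*)
import Relation.Binary.Construct.Closure.Transitive as Plus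
open import Relation.Binary.PropositionalEquality
open import Relation.Nullary using (¬_; Dec; _×-dec_)
open import Relation.Nullary.Decidable using (map′)

unique∧same-members⇒length≡ : {A : Set} {xs ys : List A} → Unique xs → Unique ys →
  (∀ {x} → x ∈ xs ⇔ x ∈ ys) → length xs ≡ length ys
unique∧same-members⇒length≡ uxs uys same = ↭-length (∼bag⇒↭ (unique∧set⇒bag uxs uys same))

-- The constructors are opened locally: a global _∷_ of All would make the solver's variable lists ambiguous.
module _ where
  open Data.List.Relation.Unary.All using ([]; _∷_)
  open Data.List.Relation.Unary.AllPairs using ([]; _∷_)

  All-mapWith∈ : {A B : Set} {P : A → Set} {Q : B → Set} {xs : List A}
    (f : ∀ {x} → x ∈ xs → B) → (∀ {x} (x∈ : x ∈ xs) → P x → Q (f x∈)) →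
    All P xs → All Q (mapWith∈ xs f)
  All-mapWith∈ f hom []         = []
  All-mapWith∈ f hom (Px ∷ Pxs) = hom (here refl) Px ∷ All-mapWith∈ (f ∘ there) (hom ∘ there) Pxs

  AllPairs-mapWith∈ : {A B : Set} {R : A → A → Set} {S : B → B → Set} {xs : List A}
    (f : ∀ {x} → x ∈ xs → B) → (∀ {x y} (x∈ : x ∈ xs) (y∈ : y ∈ xs) → R x y → S (f x∈) (f y∈)) →
    AllPairs R xs → AllPairs S (mapWith∈ xs f)
  AllPairs-mapWith∈ f hom []         = []
  AllPairs-mapWith∈ f hom (Rx ∷ Rxs) =
    All-mapWith∈ (f ∘ there) (λ y∈ → hom (here refl) (there y∈)) Rx
    ∷ AllPairs-mapWith∈ (f ∘ there) (λ x∈ y∈ → hom (there x∈) (there y∈)) Rxs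

≡-triple : {A : Set} {x x' y y' z z' : A} → x ≡ x' → y ≡ y' → z ≡ z' → (x , y , z) ≡ (x' , y' , z')
≡-triple refl refl refl = refl

≤-by-difference : ∀ {d i j} → + 0 ≤ d → j - i ≡ d → i ≤ j
≤-by-difference 0≤d refl = ℤ.0≤i-j⇒j≤i 0≤d

≤-by-differences : ∀ {d e i j} → + 0 ≤ d → + 0 ≤ e → j - i ≡ d + e → i ≤ j
≤-by-differences 0≤d 0≤e = ≤-by-difference (ℤ.+-mono-≤ 0≤d 0≤e)

gap : ∀ {i j} → i ≤ j → + 0 ≤ j - i
gap = ℤ.i≤j⇒0≤j-i

≤-negate : ∀ {i j} → i ≤ j ⇔ - j ≤ - i
≤-negate = mk⇔ ℤ.neg-mono-≤ ℤ.neg-cancel-≤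

≤-translate : ∀ s {i j} → i ≤ j ⇔ i + s ≤ j + s
≤-translate s {i} {j} = mk⇔ (ℤ.+-monoˡ-≤ s) cancel
  where
  cancel : i + s ≤ j + s → i ≤ j
  cancel h = ≤-by-difference (gap h) (solve (i ∷ j ∷ s ∷ []))

neg-swapʳ : ∀ a x y → a ≤ - (x + y) → y ≤ - (x + a)
neg-swapʳ a x y h = ≤-by-difference (gap h) (solve (a ∷ x ∷ y ∷ []))

neg-swapˡ : ∀ a x y → a ≤ - (x + y) → x ≤ - (a + y)
neg-swapˡ a x y h = ≤-by-difference (gap h) (solve (a ∷ x ∷ y ∷ []))

neg-swapʳ′ : ∀ b x y → - (x + y) ≤ b → - (x + b) ≤ y
neg-swapʳ′ b x y h = ≤-by-difference (gap h) (solve (b ∷ x ∷ y ∷ []))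

neg-swapˡ′ : ∀ b x y → - (x + y) ≤ b → - (b + y) ≤ x
neg-swapˡ′ b x y h = ≤-by-difference (gap h) (solve (b ∷ x ∷ y ∷ []))

-[i+-[i+j]]≡j : ∀ i j → - (i + - (i + j)) ≡ j
-[i+-[i+j]]≡j = solve-∀

third-coordinate : ∀ x y {c} → - (x + y) ≡ c → - (x + c) ≡ y
third-coordinate x y refl = -[i+-[i+j]]≡j x y

_∈[_,_] : ℤ → ℤ → ℤ → Set
t ∈[ lo , hi ] = lo ≤ t × t ≤ hi

infixl 6 _⊕_
_⊕_ : ∀ {i j} → + 0 ≤ i → + 0 ≤ j → + 0 ≤ i + j
_⊕_ = ℤ.+-mono-≤

0≤+ : ∀ n → + 0 ≤ + n
0≤+ n = ℤ.+≤+ z≤n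

0≤x+x⇒0≤x : ∀ x → + 0 ≤ x + x → + 0 ≤ x
0≤x+x⇒0≤x (+ n)      _  = 0≤+ n
0≤x+x⇒0≤x -[1+ n ] ()

half-difference : ∀ {A B N} → A + B ≡ N + N → B - A ≡ (N - A) + (N - A)
half-difference {A} {B} {N} eq = begin
  B - A                 ≡⟨ solve (A ∷ B ∷ []) ⟩
  (A + B) - A - A       ≡⟨ cong (λ s → s - A - A) eq ⟩
  (N + N) - A - A       ≡⟨ solve (A ∷ N ∷ []) ⟩
  (N - A) + (N - A)     ∎
  where open ≡-Reasoning

m-n≡-k⇒n≡k+m : ∀ m n k → + m - + n ≡ - + k → n ≡ k ℕ.+ m
m-n≡-k⇒n≡k+m m n k eq = ℤ.+-injective (begin
  + n                 ≡⟨ recover (+ m) (+ n) ⟩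
  - (+ m - + n) + + m ≡⟨ cong (λ t → - t + + m) eq ⟩
  - - + k + + m       ≡⟨ cong (_+ + m) (ℤ.neg-involutive (+ k)) ⟩
  + k + + m           ∎)
  where
  open ≡-Reasoning
  recover : ∀ i j → j ≡ - (i - j) + i
  recover = solve-∀

[k+m]-m≡k : ∀ k m → + (k ℕ.+ m) - + m ≡ + k
[k+m]-m≡k k m = trans (cong (_- + m) (ℤ.pos-+ k m)) (cancel (+ k) (+ m))
  where
  cancel : ∀ i j → i + j - j ≡ i
  cancel = solve-∀

m-[k+m]≡-k : ∀ k m → + m - + (k ℕ.+ m) ≡ - + k
m-[k+m]≡-k k m = trans (cong (λ t → + m - t) (ℤ.pos-+ k m)) (cancel (+ k) (+ m))
  where
  cancel : ∀ i j → j - (i + j) ≡ - i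
  cancel = solve-∀

-- The set C_n^(3)

weight : Vec3ℕ → ℕ
weight (a , b , c) = a ℕ.+ 2 ℕ.* b ℕ.+ 3 ℕ.* c

Admissible : ℕ → Vec3ℕ → Set
Admissible n w = Σ ℕ λ β → weight w ℕ.+ 3 ℕ.* β ≡ n

weightℤ : Vec3ℤ → ℤ
weightℤ (x , y , z) = x + y + y + z + z + z

weightℤ-toℤ³ : ∀ w → weightℤ (toℤ³ w) ≡ + weight w
weightℤ-toℤ³ (a , b , c) = cong +_ (unfold a b c)
  where
  unfold : ∀ a b c → a ℕ.+ b ℕ.+ b ℕ.+ c ℕ.+ c ℕ.+ c ≡ a ℕ.+ 2 ℕ.* b ℕ.+ 3 ℕ.* c
  unfold = ℕ-Solver.solve-∀

weightℤ-X₃ : ∀ {d} → d ∈ X₃ → weightℤ d ≡ + 0 ⊎ weightℤ d ≡ - + 3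
weightℤ-X₃ (here refl)                         = inj₂ refl
weightℤ-X₃ (there (here refl))                 = inj₁ refl
weightℤ-X₃ (there (there (here refl)))         = inj₁ refl
weightℤ-X₃ (there (there (there (here refl)))) = inj₂ refl

weightℤ--³ : ∀ u v → weightℤ (u -³ v) ≡ weightℤ u - weightℤ v
weightℤ--³ (x , y , z) (x' , y' , z') =
  (x - x' + (y - y') + (y - y') + (z - z') + (z - z') + (z - z') ≡
   x + y + y + z + z + z - (x' + y' + y' + z' + z' + z')) ∋ solve (x ∷ y ∷ z ∷ x' ∷ y' ∷ z' ∷ [])

weightℤ-difference : ∀ w v → weightℤ (toℤ³ w -³ toℤ³ v) ≡ + weight w - + weight v
weightℤ-difference w v = trans (weightℤ--³ (toℤ³ w) (toℤ³ v)) (cong₂ _-_ (weightℤ-toℤ³ w) (weightℤ-toℤ³ v))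

⋖-weight : ∀ w v → w ⋖ v → weight v ≡ weight w ⊎ weight v ≡ 3 ℕ.+ weight w
⋖-weight w v w⋖v with weightℤ-X₃ w⋖v
... | inj₁ eq = inj₁ (m-n≡-k⇒n≡k+m (weight w) (weight v) 0 (trans (sym (weightℤ-difference w v)) eq))
... | inj₂ eq = inj₂ (m-n≡-k⇒n≡k+m (weight w) (weight v) 3 (trans (sym (weightℤ-difference w v)) eq))

⋖-admissible : ∀ {n} w v → w ⋖ v → Admissible n v → Admissible n w
⋖-admissible w v w⋖v (β , eq) with ⋖-weight w v w⋖v
... | inj₁ same = β , trans (cong (ℕ._+ 3 ℕ.* β) (sym same)) eq
... | inj₂ up   = suc β , trans (shift (weight w) β) (trans (cong (ℕ._+ 3 ℕ.* β) (sym up)) eq)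
  where
  shift : ∀ m β → m ℕ.+ 3 ℕ.* suc β ≡ 3 ℕ.+ m ℕ.+ 3 ℕ.* β
  shift = ℕ-Solver.solve-∀

ne₁-admissible : ∀ n → Admissible n (ne₁ n)
ne₁-admissible n = 0 , padding n
  where
  padding : ∀ n → n ℕ.+ 2 ℕ.* 0 ℕ.+ 3 ℕ.* 0 ℕ.+ 3 ℕ.* 0 ≡ n
  padding = ℕ-Solver.solve-∀

≺-admissible : ∀ {n w v} → w ≺ v → Admissible n v → Admissible n w
≺-admissible {w = w} {v} Plus.[ w⋖v ]             = ⋖-admissible w v w⋖v
≺-admissible {w = w} (Plus._∷_ {y = u} w⋖u u≺v) = ⋖-admissible w u w⋖u ∘ ≺-admissible u≺v

CSet⇒Admissible : ∀ {n w} → CSet n w → Admissible n w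
CSet⇒Admissible {n} (inj₁ refl)  = ne₁-admissible n
CSet⇒Admissible {n} (inj₂ w≺ne₁) = ≺-admissible w≺ne₁ (ne₁-admissible n)

step-b : ∀ a b c → (a , suc b , c) ⋖ (2 ℕ.+ a , b , c)
step-b a b c = subst (_∈ X₃) (sym (≡-triple (m-[k+m]≡-k 2 a) ([k+m]-m≡k 1 b) ([k+m]-m≡k 0 c)))
  (there (here refl))

step-c : ∀ a b c → (a , b , suc c) ⋖ (suc a , suc b , c)
step-c a b c = subst (_∈ X₃) (sym (≡-triple (m-[k+m]≡-k 1 a) (m-[k+m]≡-k 1 b) ([k+m]-m≡k 1 c)))
  (there (there (here refl)))

step-β : ∀ a b c → (a , b , c) ⋖ (a , b , suc c)
step-β a b c = subst (_∈ X₃) (sym (≡-triple ([k+m]-m≡k 0 a) ([k+m]-m≡k 0 b) (m-[k+m]≡-k 1 c)))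
  (there (there (there (here refl))))

_⋖*_ : Vec3ℕ → Vec3ℕ → Set
_⋖*_ = Star _⋖_

climb-b : ∀ a b c → (a , b , c) ⋖* (2 ℕ.* b ℕ.+ a , 0 , c)
climb-b a zero    c = ε*
climb-b a (suc b) c =
  step-b a b c ◅ subst (λ t → (2 ℕ.+ a , b , c) ⋖* (t , 0 , c)) (shift b a) (climb-b (2 ℕ.+ a) b c)
  where
  shift : ∀ b a → 2 ℕ.* b ℕ.+ (2 ℕ.+ a) ≡ 2 ℕ.* suc b ℕ.+ a
  shift = ℕ-Solver.solve-∀

climb-c : ∀ a c → (a , 0 , c) ⋖* (3 ℕ.* c ℕ.+ a , 0 , 0)
climb-c a zero    = ε*
climb-c a (suc c) = _◅_ {j = suc a , 1 , c} (step-c a 0 c)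
  (step-b (suc a) 0 c ◅ subst (λ t → (3 ℕ.+ a , 0 , c) ⋖* (t , 0 , 0)) (shift c a) (climb-c (3 ℕ.+ a) c))
  where
  shift : ∀ c a → 3 ℕ.* c ℕ.+ (3 ℕ.+ a) ≡ 3 ℕ.* suc c ℕ.+ a
  shift = ℕ-Solver.solve-∀

climb-β : ∀ a β → (a , 0 , 0) ⋖* (3 ℕ.* β ℕ.+ a , 0 , 0)
climb-β a zero    = ε*
climb-β a (suc β) = step-β a 0 0 ◅ climb-c a 1
  ◅◅ subst (λ t → (3 ℕ.+ a , 0 , 0) ⋖* (t , 0 , 0)) (shift β a) (climb-β (3 ℕ.+ a) β)
  where
  shift : ∀ β a → 3 ℕ.* β ℕ.+ (3 ℕ.+ a) ≡ 3 ℕ.* suc β ℕ.+ a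
  shift = ℕ-Solver.solve-∀

⋖*⇒≡⊎≺ : ∀ {w v} → w ⋖* v → w ≡ v ⊎ w ≺ v
⋖*⇒≡⊎≺ ε* = inj₁ refl
⋖*⇒≡⊎≺ (w⋖u ◅ u⋖*v) with ⋖*⇒≡⊎≺ u⋖*v
... | inj₁ refl = inj₂ Plus.[ w⋖u ]
... | inj₂ u≺v  = inj₂ (w⋖u Plus.∷ u≺v)

Admissible⇒CSet : ∀ {n w} → Admissible n w → CSet n w
Admissible⇒CSet {n} {a , b , c} (β , eq) =
  ⋖*⇒≡⊎≺ (subst (λ t → (a , b , c) ⋖* (t , 0 , 0)) (trans (regroup a b c β) eq) path)
  where
  path : (a , b , c) ⋖* (3 ℕ.* β ℕ.+ (3 ℕ.* c ℕ.+ (2 ℕ.* b ℕ.+ a)) , 0 , 0)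
  path = climb-b a b c ◅◅ climb-c (2 ℕ.* b ℕ.+ a) c ◅◅ climb-β (3 ℕ.* c ℕ.+ (2 ℕ.* b ℕ.+ a)) β
  regroup : ∀ a b c β → 3 ℕ.* β ℕ.+ (3 ℕ.* c ℕ.+ (2 ℕ.* b ℕ.+ a)) ≡ a ℕ.+ 2 ℕ.* b ℕ.+ 3 ℕ.* c ℕ.+ 3 ℕ.* β
  regroup = ℕ-Solver.solve-∀

Admissible⇔divisible : ∀ n w → Admissible n w ⇔ (weight w ℕ.≤ n × 3 ∣ n ℕ.∸ weight w)
Admissible⇔divisible n w = mk⇔ to from
  where
  to : Admissible n w → weight w ℕ.≤ n × 3 ∣ n ℕ.∸ weight w
  to (β , refl) = ℕ.m≤m+n (weight w) (3 ℕ.* β) ,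
    divides β (trans (ℕ.m+n∸m≡n (weight w) (3 ℕ.* β)) (ℕ.*-comm 3 β))
  from : weight w ℕ.≤ n × 3 ∣ n ℕ.∸ weight w → Admissible n w
  from (w≤n , divides β eq) =
    β , trans (cong (λ t → weight w ℕ.+ t) (trans (ℕ.*-comm 3 β) (sym eq))) (ℕ.m+[n∸m]≡n w≤n)

admissible? : ∀ n w → Dec (Admissible n w)
admissible? n w = map′ (Equivalence.from (Admissible⇔divisible n w)) (Equivalence.to (Admissible⇔divisible n w))
  (weight w ℕ.≤? n ×-dec 3 ∣? n ℕ.∸ weight w)

cube : ℕ → List Vec3ℕ
cube n = cartesianProduct (upTo (suc n)) (cartesianProduct (upTo (suc n)) (upTo (suc n)))

cube-unique : ∀ n → Unique (cube n)
cube-unique n = Unique.cartesianProduct⁺ (Unique.upTo⁺ (suc n))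
  (Unique.cartesianProduct⁺ (Unique.upTo⁺ (suc n)) (Unique.upTo⁺ (suc n)))

admissible⇒∈cube : ∀ {n} w → Admissible n w → w ∈ cube n
admissible⇒∈cube {n} (a , b , c) (β , eq) =
  ∈-cartesianProduct⁺ (below a≤weight) (∈-cartesianProduct⁺ (below b≤weight) (below c≤weight))
  where
  below : ∀ {x} → x ℕ.≤ weight (a , b , c) → x ∈ upTo (suc n)
  below x≤ = ∈-upTo⁺ (s≤s (ℕ.≤-trans x≤ (subst (weight (a , b , c) ℕ.≤_) eq (ℕ.m≤m+n _ (3 ℕ.* β)))))
  a≤weight : a ℕ.≤ weight (a , b , c)
  a≤weight = ℕ.≤-trans (ℕ.m≤m+n a (2 ℕ.* b)) (ℕ.m≤m+n _ (3 ℕ.* c))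
  b≤weight : b ℕ.≤ weight (a , b , c)
  b≤weight = ℕ.≤-trans (ℕ.m≤m+n b (b ℕ.+ 0)) (ℕ.≤-trans (ℕ.m≤n+m (2 ℕ.* b) a) (ℕ.m≤m+n _ (3 ℕ.* c)))
  c≤weight : c ℕ.≤ weight (a , b , c)
  c≤weight = ℕ.≤-trans (ℕ.m≤m+n c (c ℕ.+ (c ℕ.+ 0))) (ℕ.m≤n+m (3 ℕ.* c) (a ℕ.+ 2 ℕ.* b))

admissibles : ℕ → List Vec3ℕ
admissibles n = filter (admissible? n) (cube n)

admissibles-unique : ∀ n → Unique (admissibles n)
admissibles-unique n = Unique.filter⁺ (admissible? n) (cube-unique n)

∈-admissibles : ∀ n w → w ∈ admissibles n ⇔ Admissible n w
∈-admissibles n w = mk⇔ (proj₂ ∘ ∈-filter⁻ (admissible? n) {xs = cube n})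
  (λ adm → ∈-filter⁺ (admissible? n) (admissible⇒∈cube w adm) adm)

CIs-admissibles : ∀ n → CIs n (length (admissibles n))
CIs-admissibles n = admissibles n , refl , admissibles-unique n ,
  λ w → mk⇔ (Admissible⇒CSet ∘ Equivalence.to (∈-admissibles n w))
            (Equivalence.from (∈-admissibles n w) ∘ CSet⇒Admissible)

-- Cube coordinates and tiling symmetries

lift₂ : ℤ → ℤ → Vec3ℤ
lift₂ x y = (x , y , - (x + y))

sum3 : Vec3ℤ → ℤ
sum3 (x , y , z) = x + y + z

negate3 : Vec3ℤ → Vec3ℤ
negate3 (x , y , z) = (- x , - y , - z)

infixl 6 _+³_

_+³_ : Vec3ℤ → Vec3ℤ → Vec3ℤ
(x , y , z) +³ (x' , y' , z') = (x + x' , y + y' , z + z')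

infix 4 _≤³_

_≤³_ : Vec3ℤ → Vec3ℤ → Set
(x , y , z) ≤³ (x' , y' , z') = x ≤ x' × y ≤ y' × z ≤ z'

signed : Bool → Vec3ℤ → Vec3ℤ
signed false q = q
signed true  q = negate3 q

act : TileSym → Vec3ℤ → Vec3ℤ
act (tsym σ ε t) q = signed ε (applyPerm σ q) +³ lift t

applySym-≡ : ∀ g p → applySym g p ≡ (proj₁ (act g (lift p)) , proj₁ (proj₂ (act g (lift p))))
applySym-≡ (tsym σ ε (t₁ , t₂)) p with applyPerm σ (lift p)
... | (x , y , z) with ε
...   | false = refl
...   | true  = refl

sum3-applyPerm : ∀ σ q → sum3 (applyPerm σ q) ≡ sum3 q
sum3-applyPerm p123 q           = refl
sum3-applyPerm p132 (x , y , z) = (x + z + y ≡ x + y + z) ∋ solve (x ∷ y ∷ z ∷ [])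
sum3-applyPerm p213 (x , y , z) = (y + x + z ≡ x + y + z) ∋ solve (x ∷ y ∷ z ∷ [])
sum3-applyPerm p231 (x , y , z) = (y + z + x ≡ x + y + z) ∋ solve (x ∷ y ∷ z ∷ [])
sum3-applyPerm p312 (x , y , z) = (z + x + y ≡ x + y + z) ∋ solve (x ∷ y ∷ z ∷ [])
sum3-applyPerm p321 (x , y , z) = (z + y + x ≡ x + y + z) ∋ solve (x ∷ y ∷ z ∷ [])

sum3-lift : ∀ p → sum3 (lift p) ≡ + 0
sum3-lift (x , y) = (x + y + - (x + y) ≡ + 0) ∋ solve (x ∷ y ∷ [])

sum3-negate3 : ∀ q → sum3 (negate3 q) ≡ - sum3 q
sum3-negate3 (x , y , z) = (- x + - y + - z ≡ - (x + y + z)) ∋ solve (x ∷ y ∷ z ∷ [])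

sum3-signed : ∀ ε q → sum3 q ≡ + 0 → sum3 (signed ε q) ≡ + 0
sum3-signed false q eq = eq
sum3-signed true  q eq = trans (sum3-negate3 q) (cong -_ eq)

sum3-+³ : ∀ u v → sum3 (u +³ v) ≡ sum3 u + sum3 v
sum3-+³ (x , y , z) (x' , y' , z') =
  (x + x' + (y + y') + (z + z') ≡ x + y + z + (x' + y' + z')) ∋ solve (x ∷ y ∷ z ∷ x' ∷ y' ∷ z' ∷ [])

sum3-act : ∀ g q → sum3 q ≡ + 0 → sum3 (act g q) ≡ + 0
sum3-act (tsym σ ε t) q eq = begin
  sum3 (signed ε (applyPerm σ q) +³ lift t)       ≡⟨ sum3-+³ (signed ε (applyPerm σ q)) (lift t) ⟩
  sum3 (signed ε (applyPerm σ q)) + sum3 (lift t) ≡⟨ cong₂ _+_ (sum3-signed ε _ (trans (sum3-applyPerm σ q) eq))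
                                                                 (sum3-lift t) ⟩
  + 0                                             ∎
  where open ≡-Reasoning

lift-zero-sum : ∀ {x y z} → x + y + z ≡ + 0 → lift (x , y) ≡ (x , y , z)
lift-zero-sum {x} {y} {z} eq = cong (λ s → (x , y , s)) (sym (begin
  z                       ≡⟨ (z ≡ - (x + y) + (x + y + z)) ∋ solve (x ∷ y ∷ z ∷ []) ⟩
  - (x + y) + (x + y + z) ≡⟨ cong (λ s → - (x + y) + s) eq ⟩
  - (x + y) + + 0         ≡⟨ ℤ.+-identityʳ _ ⟩
  - (x + y)               ∎))
  where open ≡-Reasoning

lift-applySym : ∀ g p → lift (applySym g p) ≡ act g (lift p)
lift-applySym g p = trans (cong lift (applySym-≡ g p)) (lift-zero-sum (sum3-act g (lift p) (sum3-lift p)))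

inversePerm : Perm3 → Perm3
inversePerm p231 = p312
inversePerm p312 = p231
inversePerm σ    = σ

applyPerm-inverse : ∀ σ q → applyPerm σ (applyPerm (inversePerm σ) q) ≡ q
applyPerm-inverse p123 q = refl
applyPerm-inverse p132 q = refl
applyPerm-inverse p213 q = refl
applyPerm-inverse p231 q = refl
applyPerm-inverse p312 q = refl
applyPerm-inverse p321 q = refl

signed-involutive : ∀ ε q → signed ε (signed ε q) ≡ q
signed-involutive false q           = refl
signed-involutive true  (x , y , z) = ≡-triple (ℤ.neg-involutive x) (ℤ.neg-involutive y) (ℤ.neg-involutive z)

-³-+³-cancel : ∀ u v → (u -³ v) +³ v ≡ u
-³-+³-cancel (x , y , z) (x' , y' , z') = ≡-triple (cancel x x') (cancel y y') (cancel z z')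
  where
  cancel : ∀ i j → i - j + j ≡ i
  cancel = solve-∀

sum3--³ : ∀ u v → sum3 (u -³ v) ≡ sum3 u - sum3 v
sum3--³ (x , y , z) (x' , y' , z') =
  (x - x' + (y - y') + (z - z') ≡ x + y + z - (x' + y' + z')) ∋ solve (x ∷ y ∷ z ∷ x' ∷ y' ∷ z' ∷ [])

applySym-surjective : ∀ g q → Σ Pt λ p → applySym g p ≡ q
applySym-surjective g@(tsym σ ε t) q = (proj₁ u , proj₁ (proj₂ u)) , (begin
  applySym g (proj₁ u , proj₁ (proj₂ u)) ≡⟨ applySym-≡ g _ ⟩
  drop (act g (lift (proj₁ u , proj₁ (proj₂ u)))) ≡⟨ cong (drop ∘ act g) (lift-zero-sum u-zero-sum) ⟩
  drop (act g u) ≡⟨ cong (λ r → drop (signed ε r +³ lift t)) (applyPerm-inverse σ _) ⟩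
  drop (signed ε (signed ε (lift q -³ lift t)) +³ lift t) ≡⟨ cong (λ r → drop (r +³ lift t)) (signed-involutive ε _) ⟩
  drop ((lift q -³ lift t) +³ lift t) ≡⟨ cong drop (-³-+³-cancel (lift q) (lift t)) ⟩
  q ∎)
  where
  open ≡-Reasoning
  drop : Vec3ℤ → Pt
  drop r = (proj₁ r , proj₁ (proj₂ r))
  u : Vec3ℤ
  u = applyPerm (inversePerm σ) (signed ε (lift q -³ lift t))
  u-zero-sum : sum3 u ≡ + 0
  u-zero-sum = trans (sum3-applyPerm (inversePerm σ) _) (sum3-signed ε _
    (trans (sum3--³ (lift q) (lift t)) (cong₂ _-_ (sum3-lift q) (sum3-lift t))))

Bounds : Set
Bounds = Vec3ℤ × Vec3ℤ

infix 4 _∈ᵇ_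

_∈ᵇ_ : Vec3ℤ → Bounds → Set
q ∈ᵇ (lo , hi) = lo ≤³ q × q ≤³ hi

boundsOf : THex → Bounds
boundsOf H = ((a₁ H , a₂ H , a₃ H) , (b₁ H , b₂ H , b₃ H))

∈ᴴ⇔∈ᵇ : ∀ p H → p ∈ᴴ H ⇔ lift p ∈ᵇ boundsOf H
∈ᴴ⇔∈ᵇ p H = mk⇔ (λ ((l₁ , u₁) , (l₂ , u₂) , (l₃ , u₃)) → (l₁ , l₂ , l₃) , (u₁ , u₂ , u₃))
                (λ ((l₁ , l₂ , l₃) , (u₁ , u₂ , u₃)) → (l₁ , u₁) , (l₂ , u₂) , (l₃ , u₃))

permuteᵇ : Perm3 → Bounds → Bounds
permuteᵇ σ (lo , hi) = (applyPerm σ lo , applyPerm σ hi)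

signedᵇ : Bool → Bounds → Bounds
signedᵇ false T         = T
signedᵇ true  (lo , hi) = (negate3 hi , negate3 lo)

translateᵇ : Vec3ℤ → Bounds → Bounds
translateᵇ s (lo , hi) = (lo +³ s , hi +³ s)

actᵇ : TileSym → Bounds → Bounds
actᵇ (tsym σ ε t) T = translateᵇ (lift t) (signedᵇ ε (permuteᵇ σ T))

≤³-applyPerm : ∀ σ {u v} → u ≤³ v ⇔ applyPerm σ u ≤³ applyPerm σ v
≤³-applyPerm p123 = ⇔-id _
≤³-applyPerm p132 = mk⇔ (λ (x , y , z) → (x , z , y)) (λ (x , z , y) → (x , y , z))
≤³-applyPerm p213 = mk⇔ (λ (x , y , z) → (y , x , z)) (λ (y , x , z) → (x , y , z))
≤³-applyPerm p231 = mk⇔ (λ (x , y , z) → (y , z , x)) (λ (y , z , x) → (x , y , z))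
≤³-applyPerm p312 = mk⇔ (λ (x , y , z) → (z , x , y)) (λ (z , x , y) → (x , y , z))
≤³-applyPerm p321 = mk⇔ (λ (x , y , z) → (z , y , x)) (λ (z , y , x) → (x , y , z))

≤³-negate : ∀ {u v} → u ≤³ v ⇔ negate3 v ≤³ negate3 u
≤³-negate = ≤-negate ×-⇔ ≤-negate ×-⇔ ≤-negate

≤³-translate : ∀ s {u v} → u ≤³ v ⇔ u +³ s ≤³ v +³ s
≤³-translate (s₁ , s₂ , s₃) = ≤-translate s₁ ×-⇔ ≤-translate s₂ ×-⇔ ≤-translate s₃

∈ᵇ-signed : ∀ ε q T → q ∈ᵇ T ⇔ signed ε q ∈ᵇ signedᵇ ε T
∈ᵇ-signed false q T = ⇔-id _
∈ᵇ-signed true  q T =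
  mk⇔ (λ (l , u) → to ≤³-negate u , to ≤³-negate l) (λ (u , l) → from ≤³-negate l , from ≤³-negate u)
  where open Equivalence

∈ᵇ-act : ∀ g q T → q ∈ᵇ T ⇔ act g q ∈ᵇ actᵇ g T
∈ᵇ-act (tsym σ ε t) q (lo , hi) =
  ((≤³-translate (lift t) ×-⇔ ≤³-translate (lift t)) ⇔-∘ ∈ᵇ-signed ε (applyPerm σ q) (permuteᵇ σ (lo , hi)))
  ⇔-∘ (≤³-applyPerm σ ×-⇔ ≤³-applyPerm σ)

≤³-antisym : ∀ {u v} → u ≤³ v → v ≤³ u → u ≡ v
≤³-antisym (x≤ , y≤ , z≤) (≥x , ≥y , ≥z) = ≡-triple (ℤ.≤-antisym x≤ ≥x) (ℤ.≤-antisym y≤ ≥y) (ℤ.≤-antisym z≤ ≥z)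

widths : Bounds → Vec3ℤ
widths (lo , hi) = hi -³ lo

-- The side lengths of the triangles x ≥ l₁, y ≥ l₂, z ≥ l₃ and x ≤ u₁, y ≤ u₂, z ≤ u₃ for T = (l , u).
loSide : Bounds → ℤ
loSide (lo , hi) = - sum3 lo

hiSide : Bounds → ℤ
hiSide (lo , hi) = sum3 hi

sides : Bounds → ℤ × ℤ
sides T = (loSide T , hiSide T)

swapIf : Bool → ℤ × ℤ → ℤ × ℤ
swapIf false (A , B) = (A , B)
swapIf true  (A , B) = (B , A)

applyPerm--³ : ∀ σ u v → applyPerm σ (u -³ v) ≡ applyPerm σ u -³ applyPerm σ v
applyPerm--³ p123 _ _ = refl
applyPerm--³ p132 _ _ = refl
applyPerm--³ p213 _ _ = refl
applyPerm--³ p231 _ _ = refl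
applyPerm--³ p312 _ _ = refl
applyPerm--³ p321 _ _ = refl

widths-signedᵇ : ∀ ε T → widths (signedᵇ ε T) ≡ widths T
widths-signedᵇ false T = refl
widths-signedᵇ true ((l₁ , l₂ , l₃) , (u₁ , u₂ , u₃)) =
  ≡-triple (flip-width l₁ u₁) (flip-width l₂ u₂) (flip-width l₃ u₃)
  where
  flip-width : ∀ l u → - l - - u ≡ u - l
  flip-width = solve-∀

widths-translateᵇ : ∀ s T → widths (translateᵇ s T) ≡ widths T
widths-translateᵇ (s₁ , s₂ , s₃) ((l₁ , l₂ , l₃) , (u₁ , u₂ , u₃)) =
  ≡-triple (shift-width l₁ u₁ s₁) (shift-width l₂ u₂ s₂) (shift-width l₃ u₃ s₃)
  where
  shift-width : ∀ l u s → u + s - (l + s) ≡ u - l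
  shift-width = solve-∀

widths-actᵇ : ∀ σ ε t T → widths (actᵇ (tsym σ ε t) T) ≡ applyPerm σ (widths T)
widths-actᵇ σ ε t (lo , hi) = begin
  widths (translateᵇ (lift t) T₀)  ≡⟨ widths-translateᵇ (lift t) T₀ ⟩
  widths T₀                        ≡⟨ widths-signedᵇ ε (permuteᵇ σ (lo , hi)) ⟩
  applyPerm σ hi -³ applyPerm σ lo ≡⟨ sym (applyPerm--³ σ hi lo) ⟩
  applyPerm σ (hi -³ lo)           ∎
  where
  open ≡-Reasoning
  T₀ = signedᵇ ε (permuteᵇ σ (lo , hi))

sum3-+³-zero : ∀ u s → sum3 s ≡ + 0 → sum3 (u +³ s) ≡ sum3 u
sum3-+³-zero u s eq = trans (sum3-+³ u s) (trans (cong (λ k → sum3 u + k) eq) (ℤ.+-identityʳ (sum3 u)))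

sides-actᵇ : ∀ σ ε t T → sides (actᵇ (tsym σ ε t) T) ≡ swapIf ε (sides T)
sides-actᵇ σ ε t (lo , hi) = begin
  sides (translateᵇ (lift t) (signedᵇ ε (permuteᵇ σ (lo , hi)))) ≡⟨ translated (signedᵇ ε (permuteᵇ σ (lo , hi))) ⟩
  sides (signedᵇ ε (permuteᵇ σ (lo , hi)))                      ≡⟨ signed-sides ε ⟩
  swapIf ε (sides (permuteᵇ σ (lo , hi)))                       ≡⟨ cong (swapIf ε) permuted ⟩
  swapIf ε (sides (lo , hi))                                    ∎
  where
  open ≡-Reasoning
  translated : ∀ T → sides (translateᵇ (lift t) T) ≡ sides T
  translated (lo' , hi') =
    cong₂ _,_ (cong -_ (sum3-+³-zero lo' (lift t) (sum3-lift t))) (sum3-+³-zero hi' (lift t) (sum3-lift t))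
  signed-sides : ∀ ε → sides (signedᵇ ε (permuteᵇ σ (lo , hi))) ≡ swapIf ε (sides (permuteᵇ σ (lo , hi)))
  signed-sides false = refl
  signed-sides true  =
    cong₂ _,_ (trans (cong -_ (sum3-negate3 (applyPerm σ hi))) (ℤ.neg-involutive _)) (sum3-negate3 (applyPerm σ lo))
  permuted : sides (permuteᵇ σ (lo , hi)) ≡ sides (lo , hi)
  permuted = cong₂ _,_ (cong -_ (sum3-applyPerm σ lo)) (sum3-applyPerm σ hi)

-- Tight bounds

Fits : ℤ → ℤ → ℤ → Set
Fits A B w = + 0 ≤ w × w ≤ A × w ≤ B

AllFit : ℤ × ℤ → Vec3ℤ → Set
AllFit (A , B) (w₁ , w₂ , w₃) = Fits A B w₁ × Fits A B w₂ × Fits A B w₃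

-- Tight T is AllFit (sides T) (widths T), spelled out so that, once T is a literal tuple, its
-- fields have types the ring solver can read.
Tight : Bounds → Set
Tight ((l₁ , l₂ , l₃) , (u₁ , u₂ , u₃)) = AllFit (- (l₁ + l₂ + l₃) , u₁ + u₂ + u₃) (u₁ - l₁ , u₂ - l₂ , u₃ - l₃)

Tight⇒AllFit : ∀ T → Tight T → AllFit (sides T) (widths T)
Tight⇒AllFit ((_ , _ , _) , (_ , _ , _)) tight = tight

AllFit⇒Tight : ∀ T → AllFit (sides T) (widths T) → Tight T
AllFit⇒Tight ((_ , _ , _) , (_ , _ , _)) fit = fit

AllFit-applyPerm : ∀ {AB} σ ws → AllFit AB ws → AllFit AB (applyPerm σ ws)
AllFit-applyPerm p123 _ fit            = fit
AllFit-applyPerm p132 _ (f₁ , f₂ , f₃) = f₁ , f₃ , f₂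
AllFit-applyPerm p213 _ (f₁ , f₂ , f₃) = f₂ , f₁ , f₃
AllFit-applyPerm p231 _ (f₁ , f₂ , f₃) = f₂ , f₃ , f₁
AllFit-applyPerm p312 _ (f₁ , f₂ , f₃) = f₃ , f₁ , f₂
AllFit-applyPerm p321 _ (f₁ , f₂ , f₃) = f₃ , f₂ , f₁

AllFit-swapIf : ∀ ε {AB} ws → AllFit AB ws → AllFit (swapIf ε AB) ws
AllFit-swapIf false _ fit = fit
AllFit-swapIf true  _ ((0≤w₁ , w₁≤A , w₁≤B) , (0≤w₂ , w₂≤A , w₂≤B) , (0≤w₃ , w₃≤A , w₃≤B)) =
  (0≤w₁ , w₁≤B , w₁≤A) , (0≤w₂ , w₂≤B , w₂≤A) , (0≤w₃ , w₃≤B , w₃≤A)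

Tight-act : ∀ g T → Tight T → Tight (actᵇ g T)
Tight-act g@(tsym σ ε t) T tight = AllFit⇒Tight (actᵇ g T)
  (subst₂ AllFit (sym (sides-actᵇ σ ε t T)) (sym (widths-actᵇ σ ε t T))
    (AllFit-swapIf ε _ (AllFit-applyPerm σ (widths T) (Tight⇒AllFit T tight))))

OnSegment : (ℤ → Pt) → ℤ → ℤ → Pt → Set
OnSegment e lo hi p = Σ ℤ λ t → t ∈[ lo , hi ] × e t ≡ p

module _ {l₁ l₂ l₃ u₁ u₂ u₃ : ℤ} (tight : Tight ((l₁ , l₂ , l₃) , (u₁ , u₂ , u₃))) where
  private
    T = ((l₁ , l₂ , l₃) , (u₁ , u₂ , u₃))
    fit₁ = proj₁ tight
    fit₂ = proj₁ (proj₂ tight)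
    fit₃ = proj₂ (proj₂ tight)
    w₁≤A = proj₁ (proj₂ fit₁)
    w₂≤A = proj₁ (proj₂ fit₂)
    w₃≤A = proj₁ (proj₂ fit₃)
    w₁≤B = proj₂ (proj₂ fit₁)
    w₂≤B = proj₂ (proj₂ fit₂)
    w₃≤B = proj₂ (proj₂ fit₃)
    l₁≤u₁ : l₁ ≤ u₁
    l₁≤u₁ = ℤ.0≤i-j⇒j≤i (proj₁ fit₁)
    l₂≤u₂ : l₂ ≤ u₂
    l₂≤u₂ = ℤ.0≤i-j⇒j≤i (proj₁ fit₂)
    l₃≤u₃ : l₃ ≤ u₃
    l₃≤u₃ = ℤ.0≤i-j⇒j≤i (proj₁ fit₃)

  vertex-u₁l₂ : lift₂ u₁ l₂ ∈ᵇ ((l₁ , l₂ , l₃) , (u₁ , u₂ , u₃))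
  vertex-u₁l₂ = (l₁≤u₁ , ℤ.≤-refl , l₃≤z) , (ℤ.≤-refl , l₂≤u₂ , z≤u₃)
    where
    l₃≤z : l₃ ≤ - (u₁ + l₂)
    l₃≤z = ≤-by-difference (gap w₁≤A) (solve (l₁ ∷ l₂ ∷ l₃ ∷ u₁ ∷ []))
    z≤u₃ : - (u₁ + l₂) ≤ u₃
    z≤u₃ = ≤-by-difference (gap w₂≤B) (solve (l₂ ∷ u₁ ∷ u₂ ∷ u₃ ∷ []))

  vertex-l₁u₂ : lift₂ l₁ u₂ ∈ᵇ ((l₁ , l₂ , l₃) , (u₁ , u₂ , u₃))
  vertex-l₁u₂ = (ℤ.≤-refl , l₂≤u₂ , l₃≤z) , (l₁≤u₁ , ℤ.≤-refl , z≤u₃)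
    where
    l₃≤z : l₃ ≤ - (l₁ + u₂)
    l₃≤z = ≤-by-difference (gap w₂≤A) (solve (l₁ ∷ l₂ ∷ l₃ ∷ u₂ ∷ []))
    z≤u₃ : - (l₁ + u₂) ≤ u₃
    z≤u₃ = ≤-by-difference (gap w₁≤B) (solve (l₁ ∷ u₁ ∷ u₂ ∷ u₃ ∷ []))

  vertex-l₁z : lift₂ l₁ (- (l₁ + u₃)) ∈ᵇ ((l₁ , l₂ , l₃) , (u₁ , u₂ , u₃))
  vertex-l₁z = (ℤ.≤-refl , l₂≤y , l₃≤z) , (l₁≤u₁ , y≤u₂ , ℤ.≤-reflexive z≡u₃)
    where
    z≡u₃ = -[i+-[i+j]]≡j l₁ u₃
    l₂≤y : l₂ ≤ - (l₁ + u₃)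
    l₂≤y = ≤-by-difference (gap w₃≤A) (solve (l₁ ∷ l₂ ∷ l₃ ∷ u₃ ∷ []))
    l₃≤z : l₃ ≤ - (l₁ + - (l₁ + u₃))
    l₃≤z = subst (l₃ ≤_) (sym z≡u₃) l₃≤u₃
    y≤u₂ : - (l₁ + u₃) ≤ u₂
    y≤u₂ = ≤-by-difference (gap w₁≤B) (solve (l₁ ∷ u₁ ∷ u₂ ∷ u₃ ∷ []))

  vertex-u₁z : lift₂ u₁ (- (u₁ + l₃)) ∈ᵇ ((l₁ , l₂ , l₃) , (u₁ , u₂ , u₃))
  vertex-u₁z = (l₁≤u₁ , l₂≤y , ℤ.≤-reflexive (sym z≡l₃)) , (ℤ.≤-refl , y≤u₂ , z≤u₃)
    where
    z≡l₃ = -[i+-[i+j]]≡j u₁ l₃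
    l₂≤y : l₂ ≤ - (u₁ + l₃)
    l₂≤y = ≤-by-difference (gap w₁≤A) (solve (l₁ ∷ l₂ ∷ l₃ ∷ u₁ ∷ []))
    y≤u₂ : - (u₁ + l₃) ≤ u₂
    y≤u₂ = ≤-by-difference (gap w₃≤B) (solve (l₃ ∷ u₁ ∷ u₂ ∷ u₃ ∷ []))
    z≤u₃ : - (u₁ + - (u₁ + l₃)) ≤ u₃
    z≤u₃ = subst (_≤ u₃) (sym z≡l₃) l₃≤u₃

  tight-bounds-minimal : ∀ {l₁' l₂' l₃' u₁' u₂' u₃'} →
    (∀ p → lift p ∈ᵇ ((l₁ , l₂ , l₃) , (u₁ , u₂ , u₃)) → lift p ∈ᵇ ((l₁' , l₂' , l₃') , (u₁' , u₂' , u₃'))) →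
    (l₁' , l₂' , l₃') ≤³ (l₁ , l₂ , l₃) × (u₁ , u₂ , u₃) ≤³ (u₁' , u₂' , u₃')
  tight-bounds-minimal {l₃' = l₃'} {u₃' = u₃'} ⊆T' =
    (l₁'≤l₁ , l₂'≤l₂ , subst (l₃' ≤_) (-[i+-[i+j]]≡j u₁ l₃) l₃'≤z) ,
    (u₁≤u₁' , u₂≤u₂' , subst (_≤ u₃') (-[i+-[i+j]]≡j l₁ u₃) z≤u₃')
    where
    l₂'≤l₂ = proj₁ (proj₂ (proj₁ (⊆T' (u₁ , l₂) vertex-u₁l₂)))
    u₁≤u₁' = proj₁ (proj₂ (⊆T' (u₁ , l₂) vertex-u₁l₂))
    l₁'≤l₁ = proj₁ (proj₁ (⊆T' (l₁ , u₂) vertex-l₁u₂))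
    u₂≤u₂' = proj₁ (proj₂ (proj₂ (⊆T' (l₁ , u₂) vertex-l₁u₂)))
    z≤u₃'  = proj₂ (proj₂ (proj₂ (⊆T' (l₁ , - (l₁ + u₃)) vertex-l₁z)))
    l₃'≤z  = proj₂ (proj₂ (proj₁ (⊆T' (u₁ , - (u₁ + l₃)) vertex-u₁z)))

  face-u₁ : ∀ x y → (lift₂ x y ∈ᵇ T × x ≡ u₁) ⇔ OnSegment (u₁ ,_) l₂ (- (u₁ + l₃)) (x , y)
  face-u₁ x y = mk⇔ to from
    where
    to : lift₂ x y ∈ᵇ T × x ≡ u₁ → OnSegment (u₁ ,_) l₂ (- (u₁ + l₃)) (x , y)
    to (((_ , l₂≤y , l₃≤z) , _) , refl) = y , (l₂≤y , neg-swapʳ l₃ u₁ y l₃≤z) , refl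
    from : OnSegment (u₁ ,_) l₂ (- (u₁ + l₃)) (x , y) → lift₂ x y ∈ᵇ T × x ≡ u₁
    from (t , (l₂≤t , t≤) , refl) =
      ((l₁≤u₁ , l₂≤t , neg-swapʳ t u₁ l₃ t≤) , (ℤ.≤-refl , ℤ.≤-trans t≤ end≤u₂ , z≤u₃)) , refl
      where
      end≤u₂ : - (u₁ + l₃) ≤ u₂
      end≤u₂ = ≤-by-difference (gap w₃≤B) (solve (l₃ ∷ u₁ ∷ u₂ ∷ u₃ ∷ []))
      z≤u₃ : - (u₁ + t) ≤ u₃
      z≤u₃ = ≤-by-differences (gap l₂≤t) (gap w₂≤B) (solve (t ∷ l₂ ∷ u₁ ∷ u₂ ∷ u₃ ∷ []))

  face-u₂ : ∀ x y → (lift₂ x y ∈ᵇ T × y ≡ u₂) ⇔ OnSegment (_, u₂) l₁ (- (l₃ + u₂)) (x , y)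
  face-u₂ x y = mk⇔ to from
    where
    to : lift₂ x y ∈ᵇ T × y ≡ u₂ → OnSegment (_, u₂) l₁ (- (l₃ + u₂)) (x , y)
    to (((l₁≤x , _ , l₃≤z) , _) , refl) = x , (l₁≤x , neg-swapˡ l₃ x u₂ l₃≤z) , refl
    from : OnSegment (_, u₂) l₁ (- (l₃ + u₂)) (x , y) → lift₂ x y ∈ᵇ T × y ≡ u₂
    from (t , (l₁≤t , t≤) , refl) =
      ((l₁≤t , l₂≤u₂ , neg-swapˡ t l₃ u₂ t≤) , (ℤ.≤-trans t≤ end≤u₁ , ℤ.≤-refl , z≤u₃)) , refl
      where
      end≤u₁ : - (l₃ + u₂) ≤ u₁
      end≤u₁ = ≤-by-difference (gap w₃≤B) (solve (l₃ ∷ u₁ ∷ u₂ ∷ u₃ ∷ []))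
      z≤u₃ : - (t + u₂) ≤ u₃
      z≤u₃ = ≤-by-differences (gap l₁≤t) (gap w₁≤B) (solve (t ∷ l₁ ∷ u₁ ∷ u₂ ∷ u₃ ∷ []))

  face-u₃ : ∀ x y → (lift₂ x y ∈ᵇ T × - (x + y) ≡ u₃) ⇔ OnSegment (λ t → t , - (t + u₃)) l₁ (- (l₂ + u₃)) (x , y)
  face-u₃ x y = mk⇔ to from
    where
    to : lift₂ x y ∈ᵇ T × - (x + y) ≡ u₃ → OnSegment (λ t → t , - (t + u₃)) l₁ (- (l₂ + u₃)) (x , y)
    to (((l₁≤x , l₂≤y , _) , _) , z≡u₃) =
      x , (l₁≤x , neg-swapˡ l₂ x u₃ (subst (l₂ ≤_) (sym y≡) l₂≤y)) , cong (x ,_) y≡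
      where
      y≡ = third-coordinate x y z≡u₃
    from : OnSegment (λ t → t , - (t + u₃)) l₁ (- (l₂ + u₃)) (x , y) → lift₂ x y ∈ᵇ T × - (x + y) ≡ u₃
    from (t , (l₁≤t , t≤) , refl) =
      ((l₁≤t , neg-swapˡ t l₂ u₃ t≤ , subst (l₃ ≤_) (sym z≡u₃) l₃≤u₃) ,
       (ℤ.≤-trans t≤ end≤u₁ , y≤u₂ , ℤ.≤-reflexive z≡u₃)) , z≡u₃
      where
      z≡u₃ = -[i+-[i+j]]≡j t u₃
      end≤u₁ : - (l₂ + u₃) ≤ u₁
      end≤u₁ = ≤-by-difference (gap w₂≤B) (solve (l₂ ∷ u₁ ∷ u₂ ∷ u₃ ∷ []))
      y≤u₂ : - (t + u₃) ≤ u₂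
      y≤u₂ = ≤-by-differences (gap l₁≤t) (gap w₁≤B) (solve (t ∷ l₁ ∷ u₁ ∷ u₂ ∷ u₃ ∷ []))

  face-l₁ : ∀ x y → (lift₂ x y ∈ᵇ T × x ≡ l₁) ⇔ OnSegment (l₁ ,_) (- (l₁ + u₃)) u₂ (x , y)
  face-l₁ x y = mk⇔ to from
    where
    to : lift₂ x y ∈ᵇ T × x ≡ l₁ → OnSegment (l₁ ,_) (- (l₁ + u₃)) u₂ (x , y)
    to ((_ , (_ , y≤u₂ , z≤u₃)) , refl) = y , (neg-swapʳ′ u₃ l₁ y z≤u₃ , y≤u₂) , refl
    from : OnSegment (l₁ ,_) (- (l₁ + u₃)) u₂ (x , y) → lift₂ x y ∈ᵇ T × x ≡ l₁
    from (t , (≤t , t≤u₂) , refl) =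
      ((ℤ.≤-refl , ℤ.≤-trans l₂≤end ≤t , l₃≤z) , (l₁≤u₁ , t≤u₂ , neg-swapʳ′ t l₁ u₃ ≤t)) , refl
      where
      l₂≤end : l₂ ≤ - (l₁ + u₃)
      l₂≤end = ≤-by-difference (gap w₃≤A) (solve (l₁ ∷ l₂ ∷ l₃ ∷ u₃ ∷ []))
      l₃≤z : l₃ ≤ - (l₁ + t)
      l₃≤z = ≤-by-differences (gap t≤u₂) (gap w₂≤A) (solve (t ∷ l₁ ∷ l₂ ∷ l₃ ∷ u₂ ∷ []))

  face-l₂ : ∀ x y → (lift₂ x y ∈ᵇ T × y ≡ l₂) ⇔ OnSegment (_, l₂) (- (u₃ + l₂)) u₁ (x , y)
  face-l₂ x y = mk⇔ to from
    where
    to : lift₂ x y ∈ᵇ T × y ≡ l₂ → OnSegment (_, l₂) (- (u₃ + l₂)) u₁ (x , y)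
    to ((_ , (x≤u₁ , _ , z≤u₃)) , refl) = x , (neg-swapˡ′ u₃ x l₂ z≤u₃ , x≤u₁) , refl
    from : OnSegment (_, l₂) (- (u₃ + l₂)) u₁ (x , y) → lift₂ x y ∈ᵇ T × y ≡ l₂
    from (t , (≤t , t≤u₁) , refl) =
      ((ℤ.≤-trans l₁≤end ≤t , ℤ.≤-refl , l₃≤z) , (t≤u₁ , l₂≤u₂ , neg-swapˡ′ t u₃ l₂ ≤t)) , refl
      where
      l₁≤end : l₁ ≤ - (u₃ + l₂)
      l₁≤end = ≤-by-difference (gap w₃≤A) (solve (l₁ ∷ l₂ ∷ l₃ ∷ u₃ ∷ []))
      l₃≤z : l₃ ≤ - (t + l₂)
      l₃≤z = ≤-by-differences (gap t≤u₁) (gap w₁≤A) (solve (t ∷ l₁ ∷ l₂ ∷ l₃ ∷ u₁ ∷ []))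

  face-l₃ : ∀ x y → (lift₂ x y ∈ᵇ T × - (x + y) ≡ l₃) ⇔ OnSegment (λ t → t , - (t + l₃)) (- (u₂ + l₃)) u₁ (x , y)
  face-l₃ x y = mk⇔ to from
    where
    to : lift₂ x y ∈ᵇ T × - (x + y) ≡ l₃ → OnSegment (λ t → t , - (t + l₃)) (- (u₂ + l₃)) u₁ (x , y)
    to ((_ , (x≤u₁ , y≤u₂ , _)) , z≡l₃) =
      x , (neg-swapˡ′ u₂ x l₃ (subst (_≤ u₂) (sym y≡) y≤u₂) , x≤u₁) , cong (x ,_) y≡
      where
      y≡ = third-coordinate x y z≡l₃
    from : OnSegment (λ t → t , - (t + l₃)) (- (u₂ + l₃)) u₁ (x , y) → lift₂ x y ∈ᵇ T × - (x + y) ≡ l₃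
    from (t , (≤t , t≤u₁) , refl) =
      ((ℤ.≤-trans l₁≤end ≤t , l₂≤y , ℤ.≤-reflexive (sym z≡l₃)) ,
       (t≤u₁ , neg-swapˡ′ t u₂ l₃ ≤t , subst (_≤ u₃) (sym z≡l₃) l₃≤u₃)) , z≡l₃
      where
      z≡l₃ = -[i+-[i+j]]≡j t l₃
      l₁≤end : l₁ ≤ - (u₂ + l₃)
      l₁≤end = ≤-by-difference (gap w₂≤A) (solve (l₁ ∷ l₂ ∷ l₃ ∷ u₂ ∷ []))
      l₂≤y : l₂ ≤ - (t + l₃)
      l₂≤y = ≤-by-differences (gap t≤u₁) (gap w₁≤A) (solve (t ∷ l₁ ∷ l₂ ∷ l₃ ∷ u₁ ∷ []))

tight-unique : ∀ T T' → Tight T → Tight T' → (∀ p → lift p ∈ᵇ T ⇔ lift p ∈ᵇ T') → T ≡ T'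
tight-unique ((_ , _ , _) , (_ , _ , _)) ((_ , _ , _) , (_ , _ , _)) tight tight' same =
  cong₂ _,_ (≤³-antisym (proj₁ T'⊆T) (proj₁ T⊆T')) (≤³-antisym (proj₂ T⊆T') (proj₂ T'⊆T))
  where
  T⊆T' = tight-bounds-minimal tight (Equivalence.to ∘ same)
  T'⊆T = tight-bounds-minimal tight' (Equivalence.from ∘ same)
module _ (f : Pt → ℤ) where

  foldr-⊔-upper : ∀ {xs d p} → p ∈ xs → f p ≤ foldr (λ q m → f q ⊔ m) d xs
  foldr-⊔-upper {x ∷ xs} (here refl) = ℤ.i≤i⊔j (f x) _
  foldr-⊔-upper {x ∷ xs} (there p∈) = ℤ.≤-trans (foldr-⊔-upper p∈) (ℤ.i≤j⊔i (f x) _)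

  foldr-⊔-selective : ∀ xs d → let m = foldr (λ q m → f q ⊔ m) d xs in m ≡ d ⊎ Σ Pt λ p → p ∈ xs × f p ≡ m
  foldr-⊔-selective []       d = inj₁ refl
  foldr-⊔-selective (x ∷ xs) d with ℤ.⊔-sel (f x) (foldr (λ q m → f q ⊔ m) d xs) | foldr-⊔-selective xs d
  ... | inj₁ left  | _                  = inj₂ (x , here refl , sym left)
  ... | inj₂ right | inj₁ rest≡d        = inj₁ (trans right rest≡d)
  ... | inj₂ right | inj₂ (p , p∈ , eq) = inj₂ (p , there p∈ , trans eq (sym right))

π₁ π₂ π₃ : Vec3ℤ → ℤ
π₁ = proj₁
π₂ = proj₁ ∘ proj₂
π₃ = proj₂ ∘ proj₂

Attains : Bounds → (Vec3ℤ → ℤ) → ℤ → Set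
Attains T π b = Σ Pt λ p → lift p ∈ᵇ T × π (lift p) ≡ b

attained⇒tight : ∀ {l₁ l₂ l₃ u₁ u₂ u₃} → let T = ((l₁ , l₂ , l₃) , (u₁ , u₂ , u₃)) in
  Attains T π₁ u₁ → Attains T π₁ l₁ → Attains T π₂ u₂ → Attains T π₂ l₂ →
  Attains T π₃ u₃ → Attains T π₃ l₃ → Tight T
-- Matching the equations with refl replaces each bound by a coordinate of the point attaining it:
-- u₁ = x₁, l₁ = x₂, u₂ = y₃, l₂ = y₄, u₃ = -(x₅ + y₅) and l₃ = -(x₆ + y₆).
attained⇒tight
  ((x₁ , y₁) , ((l₁≤x₁ , l₂≤y₁ , l₃≤z₁) , _) , refl)
  ((x₂ , y₂) , (_ , (_ , y₂≤u₂ , z₂≤u₃)) , refl)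
  ((x₃ , y₃) , ((l₁≤x₃ , l₂≤y₃ , l₃≤z₃) , _) , refl)
  ((x₄ , y₄) , (_ , (x₄≤u₁ , _ , z₄≤u₃)) , refl)
  ((x₅ , y₅) , ((l₁≤x₅ , l₂≤y₅ , l₃≤z₅) , _) , refl)
  ((x₆ , y₆) , (_ , (x₆≤u₁ , y₆≤u₂ , _)) , refl) =
  (gap l₁≤x₁ , w₁≤A , w₁≤B) , (gap l₂≤y₃ , w₂≤A , w₂≤B) , (gap l₃≤z₅ , w₃≤A , w₃≤B)
  where
  w₁≤A : x₁ - x₂ ≤ - (x₂ + y₄ + - (x₆ + y₆))
  w₁≤A = ≤-by-differences (gap {y₄} {y₁} l₂≤y₁) (gap { - (x₆ + y₆)} { - (x₁ + y₁)} l₃≤z₁)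
    (solve (x₁ ∷ y₁ ∷ x₂ ∷ y₄ ∷ x₆ ∷ y₆ ∷ []))
  w₁≤B : x₁ - x₂ ≤ x₁ + y₃ + - (x₅ + y₅)
  w₁≤B = ≤-by-differences (gap {y₂} {y₃} y₂≤u₂) (gap { - (x₂ + y₂)} { - (x₅ + y₅)} z₂≤u₃)
    (solve (x₁ ∷ x₂ ∷ y₂ ∷ y₃ ∷ x₅ ∷ y₅ ∷ []))
  w₂≤A : y₃ - y₄ ≤ - (x₂ + y₄ + - (x₆ + y₆))
  w₂≤A = ≤-by-differences (gap {x₂} {x₃} l₁≤x₃) (gap { - (x₆ + y₆)} { - (x₃ + y₃)} l₃≤z₃)
    (solve (x₂ ∷ x₃ ∷ y₃ ∷ y₄ ∷ x₆ ∷ y₆ ∷ []))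
  w₂≤B : y₃ - y₄ ≤ x₁ + y₃ + - (x₅ + y₅)
  w₂≤B = ≤-by-differences (gap {x₄} {x₁} x₄≤u₁) (gap { - (x₄ + y₄)} { - (x₅ + y₅)} z₄≤u₃)
    (solve (x₁ ∷ y₃ ∷ x₄ ∷ y₄ ∷ x₅ ∷ y₅ ∷ []))
  w₃≤A : - (x₅ + y₅) - - (x₆ + y₆) ≤ - (x₂ + y₄ + - (x₆ + y₆))
  w₃≤A = ≤-by-differences (gap {x₂} {x₅} l₁≤x₅) (gap {y₄} {y₅} l₂≤y₅)
    (solve (x₂ ∷ y₄ ∷ x₅ ∷ y₅ ∷ x₆ ∷ y₆ ∷ []))
  w₃≤B : - (x₅ + y₅) - - (x₆ + y₆) ≤ x₁ + y₃ + - (x₅ + y₅)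
  w₃≤B = ≤-by-differences (gap {x₆} {x₁} x₆≤u₁) (gap {y₆} {y₃} y₆≤u₂)
    (solve (x₁ ∷ y₃ ∷ x₅ ∷ y₅ ∷ x₆ ∷ y₆ ∷ []))

Sorted : Vec3ℤ → Set
Sorted (x , y , z) = x ≤ y × y ≤ z

sorted⇒tight : ∀ T → + 0 ≤ proj₁ (widths T) → Sorted (widths T) → proj₂ (proj₂ (widths T)) ≤ loSide T →
  loSide T ≤ hiSide T → Tight T
sorted⇒tight ((_ , _ , _) , (_ , _ , _)) 0≤w₁ (w₁≤w₂ , w₂≤w₃) w₃≤A A≤B =
  (0≤w₁ , w₁≤A , ℤ.≤-trans w₁≤A A≤B) , (0≤w₂ , w₂≤A , ℤ.≤-trans w₂≤A A≤B) , (0≤w₃ , w₃≤A , ℤ.≤-trans w₃≤A A≤B)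
  where
  0≤w₂ = ℤ.≤-trans 0≤w₁ w₁≤w₂
  0≤w₃ = ℤ.≤-trans 0≤w₂ w₂≤w₃
  w₂≤A = ℤ.≤-trans w₂≤w₃ w₃≤A
  w₁≤A = ℤ.≤-trans w₁≤w₂ w₂≤A

-- The perimeter of a t-hexagon

concatMap-pairs : {A B : Set} (xs : List A) (ys : List B) →
  concatMap (λ x → map (x ,_) ys) xs ≡ cartesianProduct xs ys
concatMap-pairs []       ys = refl
concatMap-pairs (x ∷ xs) ys = cong (map (x ,_) ys ++_) (concatMap-pairs xs ys)

range-unique : ∀ lo hi → Unique (range lo hi)
range-unique lo hi = Unique.map⁺ (λ {k} {k'} eq → ℤ.+-injective (+-cancelˡ lo (+ k) (+ k') eq)) (Unique.upTo⁺ _)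

length-range : ∀ lo hi → length (range lo hi) ≡ suc ∣ hi - lo ∣
length-range lo hi = trans (length-map (λ k → lo + + k) (upTo (suc ∣ hi - lo ∣))) (length-upTo (suc ∣ hi - lo ∣))

∈-range : ∀ {lo hi t} → lo ≤ hi → t ∈ range lo hi ⇔ t ∈[ lo , hi ]
∈-range {lo} {hi} {t} lo≤hi = mk⇔ to from
  where
  span : + ∣ hi - lo ∣ ≡ hi - lo
  span = ℤ.0≤i⇒+∣i∣≡i (gap lo≤hi)
  lo+[hi-lo]≡hi : ∀ lo hi → lo + (hi - lo) ≡ hi
  lo+[hi-lo]≡hi = solve-∀
  to : t ∈ range lo hi → t ∈[ lo , hi ]
  to t∈ with ∈-map⁻ (λ k → lo + + k) t∈
  ... | k , k∈ , refl =
    subst (_≤ lo + + k) (ℤ.+-identityʳ lo) (ℤ.+-monoʳ-≤ lo (ℤ.+≤+ z≤n)) ,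
    subst (lo + + k ≤_) (trans (cong (λ s → lo + s) span) (lo+[hi-lo]≡hi lo hi))
      (ℤ.+-monoʳ-≤ lo (ℤ.+≤+ (ℕ.≤-pred (∈-upTo⁻ k∈))))
  from : t ∈[ lo , hi ] → t ∈ range lo hi
  from (lo≤t , t≤hi) = subst (_∈ range lo hi) (trans (cong (λ s → lo + s) offset) (lo+[hi-lo]≡hi lo t))
    (∈-map⁺ (λ k → lo + + k) (∈-upTo⁺ (s≤s (ℤ.drop‿+≤+ t-lo≤hi-lo))))
    where
    offset : + ∣ t - lo ∣ ≡ t - lo
    offset = ℤ.0≤i⇒+∣i∣≡i (gap lo≤t)
    t-lo≤hi-lo : + ∣ t - lo ∣ ≤ + ∣ hi - lo ∣
    t-lo≤hi-lo = subst₂ _≤_ (sym offset) (sym span) (ℤ.+-monoˡ-≤ (- lo) t≤hi)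

points≡ : ∀ H → points H ≡ filter (_∈ᴴ? H) (cartesianProduct (range (a₁ H) (b₁ H)) (range (a₂ H) (b₂ H)))
points≡ H = cong (filter (_∈ᴴ? H)) (concatMap-pairs (range (a₁ H) (b₁ H)) (range (a₂ H) (b₂ H)))

points-unique : ∀ H → Unique (points H)
points-unique H = subst Unique (sym (points≡ H))
  (Unique.filter⁺ (_∈ᴴ? H) (Unique.cartesianProduct⁺ (range-unique (a₁ H) (b₁ H)) (range-unique (a₂ H) (b₂ H))))

∈-points : ∀ H p → p ∈ points H ⇔ p ∈ᴴ H
∈-points H p = mk⇔ (proj₂ ∘ ∈-filter⁻ (_∈ᴴ? H) {xs = box} ∘ subst (p ∈_) (points≡ H))
  (λ p∈H@((a₁≤x , x≤b₁) , (a₂≤y , y≤b₂) , _) → subst (p ∈_) (sym (points≡ H)) (∈-filter⁺ (_∈ᴴ? H)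
    (∈-cartesianProduct⁺ (Equivalence.from (∈-range (a₁≤b₁ H)) (a₁≤x , x≤b₁))
                         (Equivalence.from (∈-range (a₂≤b₂ H)) (a₂≤y , y≤b₂)))
    p∈H))
  where
  box = cartesianProduct (range (a₁ H) (b₁ H)) (range (a₂ H) (b₂ H))

maxOver-upper : ∀ f H ne {p} → p ∈ᴴ H → f p ≤ maxOver f H ne
maxOver-upper f H (w , _) {p} p∈H = foldr-⊔-upper f (Equivalence.from (∈-points H p) p∈H)

maxOver-attained : ∀ f H ne → Σ Pt λ p → p ∈ᴴ H × f p ≡ maxOver f H ne
maxOver-attained f H (w , w∈H) with foldr-⊔-selective f (points H) (f w)
... | inj₁ max≡fw          = w , w∈H , sym max≡fw
... | inj₂ (p , p∈ , f≡max) = p , Equivalence.to (∈-points H p) p∈ , f≡max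

module Extremes (H : THex) (ne : NonEmpty H) (c : Pt → ℤ) where

  max min : ℤ
  max = maxOver c H ne
  min = - maxOver (λ p → - c p) H ne

  ≤max : ∀ {p} → p ∈ᴴ H → c p ≤ max
  ≤max = maxOver-upper c H ne

  min≤ : ∀ {p} → p ∈ᴴ H → min ≤ c p
  min≤ {p} p∈H = subst (min ≤_) (ℤ.neg-involutive (c p)) (ℤ.neg-mono-≤ (maxOver-upper (λ p → - c p) H ne p∈H))

  max-attained : Σ Pt λ p → p ∈ᴴ H × c p ≡ max
  max-attained = maxOver-attained c H ne

  min-attained : Σ Pt λ p → p ∈ᴴ H × c p ≡ min
  min-attained with maxOver-attained (λ p → - c p) H ne
  ... | p , p∈H , eq = p , p∈H , trans (sym (ℤ.neg-involutive (c p))) (cong -_ eq)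

  max≤ : ∀ {b} → (∀ {p} → p ∈ᴴ H → c p ≤ b) → max ≤ b
  max≤ {b} bound with max-attained
  ... | p , p∈H , eq = subst (_≤ b) eq (bound p∈H)

  ≤min : ∀ {a} → (∀ {p} → p ∈ᴴ H → a ≤ c p) → a ≤ min
  ≤min {a} bound with min-attained
  ... | p , p∈H , eq = subst (a ≤_) eq (bound p∈H)

hull : (H : THex) → NonEmpty H → Bounds
hull H ne = ((X.min , Y.min , Z.min) , (X.max , Y.max , Z.max))
  where
  module X = Extremes H ne proj₁
  module Y = Extremes H ne proj₂
  module Z = Extremes H ne zc

∈-hull : ∀ H ne p → p ∈ᴴ H ⇔ lift p ∈ᵇ hull H ne
∈-hull H ne p = mk⇔
  (λ p∈H → (X.min≤ p∈H , Y.min≤ p∈H , Z.min≤ p∈H) , (X.≤max p∈H , Y.≤max p∈H , Z.≤max p∈H))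
  (λ ((lx , ly , lz) , (ux , uy , uz)) →
    (ℤ.≤-trans (X.≤min (proj₁ ∘ proj₁)) lx , ℤ.≤-trans ux (X.max≤ (proj₂ ∘ proj₁))) ,
    (ℤ.≤-trans (Y.≤min (proj₁ ∘ proj₁ ∘ proj₂)) ly , ℤ.≤-trans uy (Y.max≤ (proj₂ ∘ proj₁ ∘ proj₂))) ,
    (ℤ.≤-trans (Z.≤min (proj₁ ∘ proj₂ ∘ proj₂)) lz , ℤ.≤-trans uz (Z.max≤ (proj₂ ∘ proj₂ ∘ proj₂))))
  where
  module X = Extremes H ne proj₁
  module Y = Extremes H ne proj₂
  module Z = Extremes H ne zc

hull-tight : ∀ H ne → Tight (hull H ne)
hull-tight H ne = attained⇒tight
  (at π₁ X.max-attained) (at π₁ X.min-attained) (at π₂ Y.max-attained)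
  (at π₂ Y.min-attained) (at π₃ Z.max-attained) (at π₃ Z.min-attained)
  where
  module X = Extremes H ne proj₁
  module Y = Extremes H ne proj₂
  module Z = Extremes H ne zc
  at : ∀ π {b} → (Σ Pt λ p → p ∈ᴴ H × π (lift p) ≡ b) → Attains (hull H ne) π b
  at π (p , p∈H , eq) = p , Equivalence.to (∈-hull H ne p) p∈H , eq

faceLength-segment : ∀ f H ne (e : ℤ → Pt) {lo hi} → (∀ {s t} → e s ≡ e t → s ≡ t) →
  (∀ p → (p ∈ᴴ H × f p ≡ maxOver f H ne) ⇔ OnSegment e lo hi p) →
  + faceLength f H ne ≡ hi - lo
faceLength-segment f H ne e {lo} {hi} e-injective face⇔segment = begin
  + (length face ℕ.∸ 1)
    ≡⟨ cong (λ n → + (n ℕ.∸ 1)) (unique∧same-members⇒length≡ face-unique segment-unique same-members) ⟩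
  + (length segment ℕ.∸ 1)
    ≡⟨ cong (λ n → + (n ℕ.∸ 1)) (trans (length-map e (range lo hi)) (length-range lo hi)) ⟩
  + ∣ hi - lo ∣            ≡⟨ ℤ.0≤i⇒+∣i∣≡i (gap lo≤hi) ⟩
  hi - lo                  ∎
  where
  open ≡-Reasoning
  on-face? = λ p → f p ℤ.≟ maxOver f H ne
  face = filter on-face? (points H)
  segment = map e (range lo hi)
  lo≤hi : lo ≤ hi
  lo≤hi with maxOver-attained f H ne
  ... | p , p∈H , on-face with Equivalence.to (face⇔segment p) (p∈H , on-face)
  ...   | _ , (lo≤t , t≤hi) , _ = ℤ.≤-trans lo≤t t≤hi
  face-unique : Unique face
  face-unique = Unique.filter⁺ on-face? (points-unique H)
  segment-unique : Unique segment
  segment-unique = Unique.map⁺ e-injective (range-unique lo hi)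
  same-members : ∀ {p} → p ∈ face ⇔ p ∈ segment
  same-members {p} = mk⇔ to from
    where
    to : p ∈ face → p ∈ segment
    to p∈face with ∈-filter⁻ on-face? {xs = points H} p∈face
    ... | p∈points , on-face
        with Equivalence.to (face⇔segment p) (Equivalence.to (∈-points H p) p∈points , on-face)
    ...   | t , t∈I , refl = ∈-map⁺ e (Equivalence.from (∈-range lo≤hi) t∈I)
    from : p ∈ segment → p ∈ face
    from p∈segment with ∈-map⁻ e p∈segment
    ... | t , t∈range , refl
        with Equivalence.from (face⇔segment (e t)) (t , Equivalence.to (∈-range lo≤hi) t∈range , refl)
    ...   | p∈H , on-face = ∈-filter⁺ on-face? (Equivalence.from (∈-points H (e t)) p∈H) on-face

neg-≡⇔ : ∀ {x M} → (- x ≡ M) ⇔ (x ≡ - M)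
neg-≡⇔ {x} {M} =
  mk⇔ (λ eq → trans (sym (ℤ.neg-involutive x)) (cong -_ eq)) (λ eq → trans (cong -_ eq) (ℤ.neg-involutive M))

pos-foldr : {A : Set} (g : A → ℕ) (xs : List A) →
  + foldr (λ a s → g a ℕ.+ s) 0 xs ≡ foldr (λ a s → + g a + s) (+ 0) xs
pos-foldr g []       = refl
pos-foldr g (x ∷ xs) = trans (ℤ.pos-+ (g x) _) (cong (λ s → + g x + s) (pos-foldr g xs))

perimeter-hull : ∀ H ne → + perimeter H ne ≡ sum3 (widths (hull H ne))
perimeter-hull H ne = begin
  + perimeter H ne
    ≡⟨ pos-foldr (λ f → faceLength f H ne) dirs ⟩
  foldr (λ f s → + faceLength f H ne + s) (+ 0) dirs
    ≡⟨ cong₂ _+_ side-u₁ (cong₂ _+_ side-u₂ (cong₂ _+_ side-u₃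
         (cong₂ _+_ side-l₁ (cong₂ _+_ side-l₂ (cong₂ _+_ side-l₃ refl))))) ⟩
  (- (u₁ + l₃) - l₂) + ((- (l₃ + u₂) - l₁) + ((- (l₂ + u₃) - l₁) +
    ((u₂ - - (l₁ + u₃)) + ((u₁ - - (u₃ + l₂)) + ((u₁ - - (u₂ + l₃)) + + 0)))))
    ≡⟨ six-sides l₁ l₂ l₃ u₁ u₂ u₃ ⟩
  sum3 (widths (hull H ne))
    ∎
  where
  open ≡-Reasoning
  l₁ = Extremes.min H ne proj₁
  l₂ = Extremes.min H ne proj₂
  l₃ = Extremes.min H ne zc
  u₁ = Extremes.max H ne proj₁
  u₂ = Extremes.max H ne proj₂
  u₃ = Extremes.max H ne zc
  tight = hull-tight H ne
  six-sides : ∀ l₁ l₂ l₃ u₁ u₂ u₃ →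
    (- (u₁ + l₃) - l₂) + ((- (l₃ + u₂) - l₁) + ((- (l₂ + u₃) - l₁) +
      ((u₂ - - (l₁ + u₃)) + ((u₁ - - (u₃ + l₂)) + ((u₁ - - (u₂ + l₃)) + + 0))))) ≡
    (u₁ - l₁) + (u₂ - l₂) + (u₃ - l₃)
  six-sides = solve-∀
  on-hull : ∀ {A B : Set} → A ⇔ B → ∀ p → (p ∈ᴴ H × A) ⇔ (lift p ∈ᵇ hull H ne × B)
  on-hull A⇔B p = ∈-hull H ne p ×-⇔ A⇔B
  side-u₁ = faceLength-segment proj₁ H ne (u₁ ,_) (cong proj₂)
    (λ p → face-u₁ tight _ _ ⇔-∘ on-hull (⇔-id _) p)
  side-u₂ = faceLength-segment proj₂ H ne (_, u₂) (cong proj₁)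
    (λ p → face-u₂ tight _ _ ⇔-∘ on-hull (⇔-id _) p)
  side-u₃ = faceLength-segment zc H ne (λ t → t , - (t + u₃)) (cong proj₁)
    (λ p → face-u₃ tight _ _ ⇔-∘ on-hull (⇔-id _) p)
  side-l₁ = faceLength-segment (λ p → - proj₁ p) H ne (l₁ ,_) (cong proj₂)
    (λ p → face-l₁ tight _ _ ⇔-∘ on-hull neg-≡⇔ p)
  side-l₂ = faceLength-segment (λ p → - proj₂ p) H ne (_, l₂) (cong proj₁)
    (λ p → face-l₂ tight _ _ ⇔-∘ on-hull neg-≡⇔ p)
  side-l₃ = faceLength-segment (λ p → - zc p) H ne (λ t → t , - (t + l₃)) (cong proj₁)
    (λ p → face-l₃ tight _ _ ⇔-∘ on-hull neg-≡⇔ p)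

Tight⇒lower≤upper : ∀ T → Tight T → proj₁ T ≤³ proj₂ T
Tight⇒lower≤upper ((_ , _ , _) , (_ , _ , _)) ((0≤w₁ , _) , (0≤w₂ , _) , (0≤w₃ , _)) =
  ℤ.0≤i-j⇒j≤i 0≤w₁ , ℤ.0≤i-j⇒j≤i 0≤w₂ , ℤ.0≤i-j⇒j≤i 0≤w₃

hull-of-tight : ∀ H ne → Tight (boundsOf H) → hull H ne ≡ boundsOf H
hull-of-tight H ne tight = tight-unique (hull H ne) (boundsOf H) (hull-tight H ne) tight
  (λ p → ∈ᴴ⇔∈ᵇ p H ⇔-∘ ⇔-sym (∈-hull H ne p))

perimeter-tight : ∀ H ne → Tight (boundsOf H) → + perimeter H ne ≡ sum3 (widths (boundsOf H))
perimeter-tight H ne tight = trans (perimeter-hull H ne) (cong (sum3 ∘ widths) (hull-of-tight H ne tight))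

-- Normal forms

shape : Vec3ℤ → ℤ → Vec3ℤ
shape (w₁ , w₂ , w₃) A = (w₂ - w₁ , w₃ - w₂ , A - w₃)

-- The bounds with lower x- and y-bound 0 whose widths w₁ ≤ w₂ ≤ w₃ and triangle sides A ≤ B
-- satisfy w₂ - w₁ = a, w₃ - w₂ = b, A - w₃ = c and B - A = d.
representative : ℤ → ℤ → ℤ → ℤ → Bounds
representative a b c d =
  ((+ 0 , + 0 , - (a + b + b + c + c + c + d)) , (b + c + c + d , a + b + c + c + d , - c))

widths-representative : ∀ a b c d →
  widths (representative a b c d) ≡ (b + c + c + d , a + b + c + c + d , a + b + b + c + c + d)
widths-representative a b c d = ≡-triple
  ((b + c + c + d - + 0 ≡ b + c + c + d) ∋ solve (b ∷ c ∷ d ∷ []))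
  ((a + b + c + c + d - + 0 ≡ a + b + c + c + d) ∋ solve (a ∷ b ∷ c ∷ d ∷ []))
  ((- c - - (a + b + b + c + c + c + d) ≡ a + b + b + c + c + d) ∋ solve (a ∷ b ∷ c ∷ d ∷ []))

sides-representative : ∀ a b c d →
  sides (representative a b c d) ≡ (a + b + b + c + c + c + d , a + b + b + c + c + c + d + d)
sides-representative a b c d = cong₂ _,_
  ((- (+ 0 + + 0 + - (a + b + b + c + c + c + d)) ≡ a + b + b + c + c + c + d) ∋ solve (a ∷ b ∷ c ∷ d ∷ []))
  ((b + c + c + d + (a + b + c + c + d) + - c ≡ a + b + b + c + c + c + d + d) ∋ solve (a ∷ b ∷ c ∷ d ∷ []))

shape-representative : ∀ a b c d → let R = representative a b c d in shape (widths R) (loSide R) ≡ (a , b , c)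
shape-representative a b c d =
  trans (cong₂ shape (widths-representative a b c d) (cong proj₁ (sides-representative a b c d)))
  (≡-triple ((a + b + c + c + d - (b + c + c + d) ≡ a) ∋ solve (a ∷ b ∷ c ∷ d ∷ []))
            ((a + b + b + c + c + d - (a + b + c + c + d) ≡ b) ∋ solve (a ∷ b ∷ c ∷ d ∷ []))
            ((a + b + b + c + c + c + d - (a + b + b + c + c + d) ≡ c) ∋ solve (a ∷ b ∷ c ∷ d ∷ [])))

-- The arguments are shape (widths T) (loSide T) and hiSide T - loSide T, written out for this T.
normal-position : ∀ l₃ u₁ u₂ u₃ → ((+ 0 , + 0 , l₃) , (u₁ , u₂ , u₃)) ≡
  representative ((u₂ - + 0) - (u₁ - + 0)) ((u₃ - l₃) - (u₂ - + 0)) (- (+ 0 + + 0 + l₃) - (u₃ - l₃))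
                 ((u₁ + u₂ + u₃) - - (+ 0 + + 0 + l₃))
normal-position l₃ u₁ u₂ u₃ = cong₂ _,_
  (≡-triple refl refl (solve (l₃ ∷ u₁ ∷ u₂ ∷ u₃ ∷ [])))
  (≡-triple (solve (l₃ ∷ u₁ ∷ u₂ ∷ u₃ ∷ [])) (solve (l₃ ∷ u₁ ∷ u₂ ∷ u₃ ∷ [])) (solve (l₃ ∷ u₁ ∷ u₂ ∷ u₃ ∷ [])))

module _ {a b c d : ℤ} (0≤a : + 0 ≤ a) (0≤b : + 0 ≤ b) (0≤c : + 0 ≤ c) (0≤d : + 0 ≤ d) where

  representative-sorted : Sorted (widths (representative a b c d))
  representative-sorted = subst Sorted (sym (widths-representative a b c d))
    (≤-by-difference 0≤a (solve (a ∷ b ∷ c ∷ d ∷ [])) , ≤-by-difference 0≤b (solve (a ∷ b ∷ c ∷ d ∷ [])))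

  representative-ordered : loSide (representative a b c d) ≤ hiSide (representative a b c d)
  representative-ordered = subst (λ (A , B) → A ≤ B) (sym (sides-representative a b c d))
    (≤-by-difference 0≤d (solve (a ∷ b ∷ c ∷ d ∷ [])))

  representative-tight : Tight (representative a b c d)
  representative-tight = sorted⇒tight (representative a b c d)
    (subst (λ ws → + 0 ≤ proj₁ ws) (sym (widths-representative a b c d)) (0≤b ⊕ 0≤c ⊕ 0≤c ⊕ 0≤d))
    representative-sorted
    (subst₂ (λ ws AB → proj₂ (proj₂ ws) ≤ proj₁ AB)
      (sym (widths-representative a b c d)) (sym (sides-representative a b c d))
      (≤-by-difference 0≤c (solve (a ∷ b ∷ c ∷ d ∷ []))))
    representative-ordered

thexOf : (T : Bounds) → proj₁ T ≤³ proj₂ T → THex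
thexOf ((l₁ , l₂ , l₃) , (u₁ , u₂ , u₃)) (l₁≤u₁ , l₂≤u₂ , l₃≤u₃) = thex l₁ u₁ l₂ u₂ l₃ u₃ l₁≤u₁ l₂≤u₂ l₃≤u₃

representativeBounds : Vec3ℕ → ℕ → Bounds
representativeBounds (a , b , c) β = representative (+ a) (+ b) (+ c) (+ β + + β)

representativeBounds-tight : ∀ w β → Tight (representativeBounds w β)
representativeBounds-tight (a , b , c) β = representative-tight (0≤+ a) (0≤+ b) (0≤+ c) (0≤+ β ⊕ 0≤+ β)

representativeBounds-sorted : ∀ w β → Sorted (widths (representativeBounds w β))
representativeBounds-sorted (a , b , c) β = representative-sorted (0≤+ a) (0≤+ b) (0≤+ c) (0≤+ β ⊕ 0≤+ β)

representativeBounds-ordered : ∀ w β → let R = representativeBounds w β in loSide R ≤ hiSide R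
representativeBounds-ordered (a , b , c) β = representative-ordered (0≤+ a) (0≤+ b) (0≤+ c) (0≤+ β ⊕ 0≤+ β)

shape-representativeBounds : ∀ w β → let R = representativeBounds w β in shape (widths R) (loSide R) ≡ toℤ³ w
shape-representativeBounds (a , b , c) β = shape-representative (+ a) (+ b) (+ c) (+ β + + β)

weight-unfolded : ∀ a b c β → weight (a , b , c) ℕ.+ 3 ℕ.* β ≡ a ℕ.+ b ℕ.+ b ℕ.+ c ℕ.+ c ℕ.+ c ℕ.+ β ℕ.+ β ℕ.+ β
weight-unfolded a b c β = unfold a b c β
  where
  unfold : ∀ a b c β → a ℕ.+ 2 ℕ.* b ℕ.+ 3 ℕ.* c ℕ.+ 3 ℕ.* β ≡ a ℕ.+ b ℕ.+ b ℕ.+ c ℕ.+ c ℕ.+ c ℕ.+ β ℕ.+ β ℕ.+ β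
  unfold = ℕ-Solver.solve-∀

perimeter-representativeBounds : ∀ w β →
  sum3 (widths (representativeBounds w β)) ≡ + (weight w ℕ.+ 3 ℕ.* β) + + (weight w ℕ.+ 3 ℕ.* β)
perimeter-representativeBounds (a , b , c) β = begin
  sum3 (widths (representativeBounds (a , b , c) β))
    ≡⟨ cong sum3 (widths-representative a' b' c' (β' + β')) ⟩
  sum3 (b' + c' + c' + (β' + β') , a' + b' + c' + c' + (β' + β') , a' + b' + b' + c' + c' + (β' + β'))
    ≡⟨ double a' b' c' β' ⟩
  S + S
    ≡⟨ cong (λ m → + m + + m) (sym (weight-unfolded a b c β)) ⟩
  + (weight (a , b , c) ℕ.+ 3 ℕ.* β) + + (weight (a , b , c) ℕ.+ 3 ℕ.* β)
    ∎
  where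
  open ≡-Reasoning
  a' = + a
  b' = + b
  c' = + c
  β' = + β
  S = a' + b' + b' + c' + c' + c' + β' + β' + β'
  double : ∀ a b c β → b + c + c + (β + β) + (a + b + c + c + (β + β)) + (a + b + b + c + c + (β + β)) ≡
    (a + b + b + c + c + c + β + β + β) + (a + b + b + c + c + c + β + β + β)
  double = solve-∀

-- Unfolding these hexagons during unification is very expensive, so they are kept opaque.
opaque
  representativeTHex : Vec3ℕ → ℕ → THex
  representativeTHex w β = thexOf (representativeBounds w β) (Tight⇒lower≤upper _ (representativeBounds-tight w β))

  ∈-representativeTHex : ∀ w β p → p ∈ᴴ representativeTHex w β ⇔ lift p ∈ᵇ representativeBounds w β
  ∈-representativeTHex w β p = ∈ᴴ⇔∈ᵇ p (representativeTHex w β)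

  representativeTHex-inhabited : ∀ w β → NonEmpty (representativeTHex w β)
  representativeTHex-inhabited w β =
    _ , Equivalence.from (∈ᴴ⇔∈ᵇ _ (representativeTHex w β)) (vertex-u₁l₂ (representativeBounds-tight w β))

  representativeTHex-perimeter : ∀ {n} w β → weight w ℕ.+ 3 ℕ.* β ≡ n → ∀ ne →
    perimeter (representativeTHex w β) ne ≡ 2 ℕ.* n
  representativeTHex-perimeter {n} w β refl ne = ℤ.+-injective (begin
    + perimeter (representativeTHex w β) ne  ≡⟨ perimeter-tight (representativeTHex w β) ne (representativeBounds-tight w β) ⟩
    sum3 (widths (representativeBounds w β)) ≡⟨ perimeter-representativeBounds w β ⟩
    + n + + n                                ≡⟨ cong (λ m → + (n ℕ.+ m)) (sym (ℕ.+-identityʳ n)) ⟩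
    + (2 ℕ.* n)                              ∎)
    where open ≡-Reasoning

representativeHex : ∀ {n} w → Admissible n w → THexPer (2 ℕ.* n)
representativeHex w (β , weight≡n) =
  mk (representativeTHex w β) (representativeTHex-inhabited w β)
     (representativeTHex-perimeter w β weight≡n (representativeTHex-inhabited w β))

sum3-widths : ∀ T → sum3 (widths T) ≡ loSide T + hiSide T
sum3-widths ((l₁ , l₂ , l₃) , (u₁ , u₂ , u₃)) =
  (u₁ - l₁ + (u₂ - l₂) + (u₃ - l₃) ≡ - (l₁ + l₂ + l₃) + (u₁ + u₂ + u₃)) ∋ solve (l₁ ∷ l₂ ∷ l₃ ∷ u₁ ∷ u₂ ∷ u₃ ∷ [])

shape-weight : ∀ {w₁ w₂ w₃ A N} → w₁ + w₂ + w₃ ≡ N + N →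
  (w₂ - w₁) + (w₃ - w₂) + (w₃ - w₂) + (A - w₃) + (A - w₃) + (A - w₃) + (N - A) + (N - A) + (N - A) ≡ N
shape-weight {w₁} {w₂} {w₃} {A} {N} eq = begin
  (w₂ - w₁) + (w₃ - w₂) + (w₃ - w₂) + (A - w₃) + (A - w₃) + (A - w₃) + (N - A) + (N - A) + (N - A)
                                 ≡⟨ solve (w₁ ∷ w₂ ∷ w₃ ∷ A ∷ N ∷ []) ⟩
  N + N + N - (w₁ + w₂ + w₃)     ≡⟨ cong (λ s → N + N + N - s) eq ⟩
  N + N + N - (N + N)            ≡⟨ solve (N ∷ []) ⟩
  N                              ∎
  where open ≡-Reasoning

normal-form : ∀ n T → Tight T → Sorted (widths T) → loSide T ≤ hiSide T → sum3 (widths T) ≡ + n + + n →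
  π₁ (proj₁ T) ≡ + 0 → π₂ (proj₁ T) ≡ + 0 →
  Σ Vec3ℕ λ w → Σ (Admissible n w) λ adm → T ≡ representativeBounds w (proj₁ adm)
normal-form n T@((_ , _ , l₃) , (u₁ , u₂ , u₃)) (_ , _ , (_ , w₃≤A , _)) (w₁≤w₂ , w₂≤w₃) A≤B sum≡ refl refl =
  (∣ a ∣ , ∣ b ∣ , ∣ c ∣) , (∣ β ∣ , weight≡n) , (begin
    T                                   ≡⟨ normal-position l₃ u₁ u₂ u₃ ⟩
    representative a b c (B - A)        ≡⟨ cong (representative a b c) (half-difference {A} {B} {N} A+B≡N+N) ⟩
    representative a b c (β + β)        ≡⟨ cong (λ (x , y , z , t) → representative x y z (t + t)) (sym casts) ⟩
    representativeBounds (∣ a ∣ , ∣ b ∣ , ∣ c ∣) ∣ β ∣ ∎)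
  where
  open ≡-Reasoning
  N = + n
  A = loSide T
  B = hiSide T
  a = (u₂ - + 0) - (u₁ - + 0)
  b = (u₃ - l₃) - (u₂ - + 0)
  c = A - (u₃ - l₃)
  β = N - A
  A+B≡N+N : A + B ≡ N + N
  A+B≡N+N = trans (sym (sum3-widths T)) sum≡
  0≤β : + 0 ≤ β
  0≤β = 0≤x+x⇒0≤x β (subst (+ 0 ≤_) (half-difference {A} {B} {N} A+B≡N+N) (gap A≤B))
  casts : (+ ∣ a ∣ , + ∣ b ∣ , + ∣ c ∣ , + ∣ β ∣) ≡ (a , b , c , β)
  casts = cong₂ _,_ (ℤ.0≤i⇒+∣i∣≡i (gap w₁≤w₂)) (cong₂ _,_ (ℤ.0≤i⇒+∣i∣≡i (gap w₂≤w₃))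
    (cong₂ _,_ (ℤ.0≤i⇒+∣i∣≡i (gap w₃≤A)) (ℤ.0≤i⇒+∣i∣≡i 0≤β)))
  weight≡n : weight (∣ a ∣ , ∣ b ∣ , ∣ c ∣) ℕ.+ 3 ℕ.* ∣ β ∣ ≡ n
  weight≡n = ℤ.+-injective (begin
    + (weight (∣ a ∣ , ∣ b ∣ , ∣ c ∣) ℕ.+ 3 ℕ.* ∣ β ∣) ≡⟨ cong +_ (weight-unfolded (∣ a ∣) (∣ b ∣) (∣ c ∣) (∣ β ∣)) ⟩
    + ∣ a ∣ + + ∣ b ∣ + + ∣ b ∣ + + ∣ c ∣ + + ∣ c ∣ + + ∣ c ∣ + + ∣ β ∣ + + ∣ β ∣ + + ∣ β ∣
      ≡⟨ cong (λ (x , y , z , t) → x + y + y + z + z + z + t + t + t) casts ⟩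
    a + b + b + c + c + c + β + β + β ≡⟨ shape-weight {u₁ - + 0} {u₂ - + 0} {u₃ - l₃} {A} {N} sum≡ ⟩
    N                                 ∎)

-- Classification

≤-cycle⇒≡ : ∀ {x y z : ℤ} → x ≤ y → y ≤ z → z ≤ x → x ≡ y × y ≡ z
≤-cycle⇒≡ x≤y y≤z z≤x = ℤ.≤-antisym x≤y (ℤ.≤-trans y≤z z≤x) , ℤ.≤-antisym y≤z (ℤ.≤-trans z≤x x≤y)

sorted-permutation : ∀ σ ws → Sorted ws → Sorted (applyPerm σ ws) → applyPerm σ ws ≡ ws
sorted-permutation p123 _ _ _ = refl
sorted-permutation p132 (x , y , z) (_ , y≤z) (_ , z≤y) with ℤ.≤-antisym y≤z z≤y
... | refl = refl
sorted-permutation p213 (x , y , z) (x≤y , _) (y≤x , _) with ℤ.≤-antisym x≤y y≤x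
... | refl = refl
sorted-permutation p231 (x , y , z) (x≤y , y≤z) (_ , z≤x) with ≤-cycle⇒≡ x≤y y≤z z≤x
... | refl , refl = refl
sorted-permutation p312 (x , y , z) (x≤y , y≤z) (z≤x , _) with ≤-cycle⇒≡ x≤y y≤z z≤x
... | refl , refl = refl
sorted-permutation p321 (x , y , z) (x≤y , y≤z) (z≤y , y≤x) with ≤-cycle⇒≡ x≤y y≤z (ℤ.≤-trans z≤y y≤x)
... | refl , refl = refl

ordered-swapIf : ∀ ε {A B A' B'} → swapIf ε (A , B) ≡ (A' , B') → A ≤ B → A' ≤ B' → A' ≡ A
ordered-swapIf false refl _   _   = refl
ordered-swapIf true  refl A≤B B≤A = ℤ.≤-antisym B≤A A≤B

toℤ³-injective : ∀ {w v} → toℤ³ w ≡ toℤ³ v → w ≡ v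
toℤ³-injective refl = refl

representative-≅⇒≡ : ∀ w v β β' → representativeTHex w β ≅ representativeTHex v β' → w ≡ v
representative-≅⇒≡ w v β β' (g@(tsym σ ε t) , iso) = toℤ³-injective (begin
  toℤ³ w                         ≡⟨ sym (shape-representativeBounds w β) ⟩
  shape (widths R) (loSide R)    ≡⟨ cong₂ shape (sym same-widths) (sym same-loSide) ⟩
  shape (widths R') (loSide R')  ≡⟨ shape-representativeBounds v β' ⟩
  toℤ³ v                         ∎)
  where
  open ≡-Reasoning
  R  = representativeBounds w β
  R' = representativeBounds v β'
  tightR  = representativeBounds-tight w β
  tightR' = representativeBounds-tight v β'
  same-points : ∀ q → lift q ∈ᵇ actᵇ g R ⇔ lift q ∈ᵇ R'
  same-points q with applySym-surjective g q
  ... | p , refl = subst (λ r → r ∈ᵇ actᵇ g R ⇔ lift (applySym g p) ∈ᵇ R') (sym (lift-applySym g p))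
    (((∈-representativeTHex v β' (applySym g p) ⇔-∘ iso p) ⇔-∘ ⇔-sym (∈-representativeTHex w β p))
      ⇔-∘ ⇔-sym (∈ᵇ-act g (lift p) R))
  moved : actᵇ g R ≡ R'
  moved = tight-unique (actᵇ g R) R' (Tight-act g R tightR) tightR' same-points
  same-widths : widths R' ≡ widths R
  same-widths = trans permuted (sorted-permutation σ (widths R) (representativeBounds-sorted w β)
    (subst Sorted permuted (representativeBounds-sorted v β')))
    where
    permuted : widths R' ≡ applyPerm σ (widths R)
    permuted = trans (cong widths (sym moved)) (widths-actᵇ σ ε t R)
  same-loSide : loSide R' ≡ loSide R
  same-loSide = ordered-swapIf ε (trans (sym (sides-actᵇ σ ε t R)) (cong sides moved))
    (representativeBounds-ordered w β) (representativeBounds-ordered v β')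

sortingPerm : ∀ ws → Σ Perm3 λ σ → Sorted (applyPerm σ ws)
sortingPerm (x , y , z) with ℤ.≤-total x y | ℤ.≤-total y z | ℤ.≤-total x z
... | inj₁ x≤y | inj₁ y≤z | _        = p123 , x≤y , y≤z
... | inj₁ x≤y | inj₂ z≤y | inj₁ x≤z = p132 , x≤z , z≤y
... | inj₁ x≤y | inj₂ z≤y | inj₂ z≤x = p312 , z≤x , x≤y
... | inj₂ y≤x | inj₁ y≤z | inj₁ x≤z = p213 , y≤x , x≤z
... | inj₂ y≤x | inj₁ y≤z | inj₂ z≤x = p231 , y≤z , z≤x
... | inj₂ y≤x | inj₂ z≤y | _        = p321 , z≤y , y≤x

orderingFlip : ∀ T → Σ Bool λ ε → proj₁ (swapIf ε (sides T)) ≤ proj₂ (swapIf ε (sides T))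
orderingFlip T with ℤ.≤-total (loSide T) (hiSide T)
... | inj₁ A≤B = false , A≤B
... | inj₂ B≤A = true  , B≤A

representative-complete : ∀ {n} (H : THexPer (2 ℕ.* n)) →
  Σ Vec3ℕ λ w → Σ (Admissible n w) λ adm → hex H ≅ representativeTHex w (proj₁ adm)
representative-complete {n} (mk H ne per) = w , adm , g , same-points
  where
  T = hull H ne
  σ = proj₁ (sortingPerm (widths T))
  ε = proj₁ (orderingFlip T)
  T₀ = signedᵇ ε (permuteᵇ σ T)
  -- the translation moves the lower x- and y-bounds of T₀ to 0
  g = tsym σ ε (- π₁ (proj₁ T₀) , - π₂ (proj₁ T₀))
  T' = actᵇ g T
  sum≡2n : sum3 (widths T') ≡ + n + + n
  sum≡2n = begin
    sum3 (widths T')               ≡⟨ cong sum3 (widths-actᵇ σ ε _ T) ⟩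
    sum3 (applyPerm σ (widths T))  ≡⟨ sum3-applyPerm σ (widths T) ⟩
    sum3 (widths T)                ≡⟨ sym (perimeter-hull H ne) ⟩
    + perimeter H ne               ≡⟨ cong +_ (trans per (cong (n ℕ.+_) (ℕ.+-identityʳ n))) ⟩
    + n + + n                      ∎
    where open ≡-Reasoning
  normal = normal-form n T' (Tight-act g T (hull-tight H ne))
    (subst Sorted (sym (widths-actᵇ σ ε _ T)) (proj₂ (sortingPerm (widths T))))
    (subst (λ AB → proj₁ AB ≤ proj₂ AB) (sym (sides-actᵇ σ ε _ T)) (proj₂ (orderingFlip T)))
    sum≡2n (ℤ.+-inverseʳ (π₁ (proj₁ T₀))) (ℤ.+-inverseʳ (π₂ (proj₁ T₀)))
  w = proj₁ normal
  adm = proj₁ (proj₂ normal)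
  R = representativeBounds w (proj₁ adm)
  same-points : ∀ p → p ∈ᴴ H ⇔ applySym g p ∈ᴴ representativeTHex w (proj₁ adm)
  same-points p = (⇔-sym (∈-representativeTHex w (proj₁ adm) (applySym g p))
    ⇔-∘ subst₂ (λ q R → lift p ∈ᵇ T ⇔ q ∈ᵇ R) (sym (lift-applySym g p)) (proj₂ (proj₂ normal)) (∈ᵇ-act g (lift p) T))
    ⇔-∘ ∈-hull H ne p

admissible-unique : ∀ {n w} (adm adm' : Admissible n w) → proj₁ adm ≡ proj₁ adm'
admissible-unique {w = w} (β , eq) (β' , eq') =
  ℕ.*-cancelˡ-≡ β β' 3 (ℕ.+-cancelˡ-≡ (weight w) _ _ (trans eq (sym eq')))

TIs-admissibles : ∀ n → TIs n (length (admissibles n))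
TIs-admissibles n = representatives , length-mapWith∈ (setoid _) (admissibles n) , pairwise-distinct , covering
  where
  admissible-at : ∀ {w} → w ∈ admissibles n → Admissible n w
  admissible-at {w} = Equivalence.to (∈-admissibles n w)
  representative-at : ∀ {w} → w ∈ admissibles n → THexPer (2 ℕ.* n)
  representative-at {w} w∈ = representativeHex w (admissible-at w∈)
  representatives = mapWith∈ (admissibles n) representative-at
  pairwise-distinct : AllPairs (λ H H' → ¬ (hex H ≅ hex H')) representatives
  pairwise-distinct = AllPairs-mapWith∈ representative-at
    (λ {w} {v} w∈ v∈ w≢v iso → w≢v (representative-≅⇒≡ w v _ _ iso)) (admissibles-unique n)
  covering : ∀ H → Any (λ H' → hex H ≅ hex H') representatives
  covering H = mapWith∈⁺ representative-at (w , w∈ ,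
    subst (λ β → hex H ≅ representativeTHex w β) (admissible-unique {w = w} adm (admissible-at w∈))
      (proj₂ (proj₂ complete)))
    where
    complete = representative-complete H
    w = proj₁ complete
    adm = proj₁ (proj₂ complete)
    w∈ = Equivalence.from (∈-admissibles n w) adm

corollary4p4 : (n : ℕ) → Σ ℕ (λ k → CIs n k × TIs n k)
corollary4p4 n = length (admissibles n) , CIs-admissibles n , TIs-admissibles n
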